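{- Let $G$ be a connected graph with a vertex $q$, and let $Q$ be the quotient graph of the split decomposition of $G$ containing $q$ as a leaf-node. Let $G'$ be obtained from $G$ by a one-vertex extension $p$ of $q$. Then the split decomposition (QASST) of $G'$ is obtained from that of $G$ by replacing $Q$ with $Q'$, where either $Q'$ is a single quotient graph obtained from $Q$ by applying the same extension $p$ of $q$ inside $Q$, or $Q'=Q_1'\cup Q_2'$ consists of two quotient graphs joined by a new pair of adjacent split-nodes, where $Q_1'$ is obtained from $Q$ by replacing $q$ with a split-node and $Q_2'$ has exactly three vertices: $q$, $p$ and a split-node. Specifically: (1) If $Q$ is a star with center $q$: (a) pendant $p$: $Q'$ is $Q$ with an added spoke $p$; (b) false twin $p$: $Q'=Q_1'\cup Q_2'$ with $Q_2'$ the star whose center is the split-node and whose spokes are $p,q$; (c) true twin $p$: $Q'=Q_1'\cup Q_2'$ with $Q_2'=K_3$. (2) If $Q$ is a star and $q$ is a spoke: (a) pendant $p$: $Q'=Q_1'\cup Q_2'$ with $Q_2'$ the star with center $q$ and spokes $p$ and the split-node; (b) false twin $p$: $Q'$ is $Q$ with an added spoke $p$; (c) true twin $p$: $Q'=Q_1'\cup Q_2'$ with $Q_2'=K_3$. (3) If $Q$ is complete: (a) pendant $p$: $Q'=Q_1'\cup Q_2'$ with $Q_2'$ the star with center $q$ and spokes $p$ and the split-node; (b) false twin $p$: $Q'=Q_1'\cup Q_2'$ with $Q_2'$ the star with center the split-node and spokes $q,p$; (c) true twin $p$: $Q'$ is $Q$ with one additional vertex $p$ adjacent to all other vertices. (4)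 If $Q$ is prime: (a) pendant $p$: $Q'=Q_1'\cup Q_2'$ with $Q_2'$ the star with center $q$ and spokes $p$ and the split-node; (b) false twin $p$: $Q'=Q_1'\cup Q_2'$ with $Q_2'$ the star with center the split-node and spokes $q,p$; (c) true twin $p$: $Q'=Q_1'\cup Q_2'$ with $Q_2'=K_3$.
   Context: A split of a connected graph $G$ is a bipartition $V(G)=U_1\cup U_2$ into nonempty sets such that the edges between $U_1$ and $U_2$ form a complete bipartite graph between the vertices of $U_1$ with a neighbour in $U_2$ and the vertices of $U_2$ with a neighbour in $U_1$; trivial if a side is a single vertex. A split is strong if no other split crosses it (two splits cross if each side of one meets each side of the other). The split decomposition (QASST) of $G$: each nontrivial strong split is collapsed into a pair of new adjacent "split-nodes" (one on each side, each adjacent to the vertices on its side having neighbours across the split), and the edge between them is recorded as a tree edge; doing this for all nontrivial strong splits yields a tree of "quotient graphs", each containing leaf-nodes (original vertices) and split-nodes, each complete, a star, or prime (having no nontrivial split). $G$ is recovered by replacing each paired split-node couple with all edges between their respective neighbours. One-vertex extensions of an existing vertex $q$: adding a pendant vertex $p$ (adjacent only to $q$), a false twin $p$ (adjacent exactly to the neighbours of $q$), or a true twin $p$ (adjacent to $q$ and to all neighbours of $q$). -}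

module Defs where

open import Data.Nat using (ℕ; zero; suc)
open import Data.Fin using (Fin; zero; suc)
open import Data.Bool using (Bool; true; false)
open import Data.Product using (Σ; ∃; ∃₂; _×_; _,_)
open import Data.Sum using (_⊎_)
open import Data.Empty using (⊥)
open import Data.Unit using (⊤)
open import Relation.Nullary using (¬_)
open import Relation.Nullary.Decidable using (⌊_⌋)
open import Relation.Binary.PropositionalEquality using (_≡_; _≢_)
open import Function.Bundles using (_⇔_)

Rel : ℕ → Set₁
Rel n = Fin n → Fin n → Set

-- Boolean-valued relations (used for partitions of the vertex set).
BRel : ℕ → Set
BRel n = Fin n → Fin n → Bool

-- Subsets of the vertex set (a bipartition U / complement).
Subset : ℕ → Set
Subset n = Fin n → Bool

Symmetric : ∀ {n} → Rel n → Set
Symmetric A = ∀ x y → A x y → A y x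

Irreflexive : ∀ {n} → Rel n → Set
Irreflexive A = ∀ x → ¬ A x x

data Path {n} (A : Rel n) : Fin n → Fin n → Set where
  here : ∀ x → Path A x x
  step : ∀ {x y z} → A x y → Path A y z → Path A x z

Connected : ∀ {n} → Rel n → Set
Connected A = ∀ x y → Path A x y

-- Splits, for a graph whose vertices are the classes of an equivalence E
-- on Fin n and whose adjacency is L (a relation on representatives).
-- For an ordinary graph take E = _≡_.

module _ {n : ℕ} (E : Rel n) (L : Rel n) where

  Saturated : Subset n → Set
  Saturated U = ∀ x y → E x y → U x ≡ U y

  IsSplit : Subset n → Set
  IsSplit U =
    Saturated U ×
    (∃ λ x → U x ≡ true) ×
    (∃ λ y → U y ≡ false) ×
    (∀ a d → U a ≡ true → U d ≡ false →
       (∃ λ b → U b ≡ false × L a b) →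
       (∃ λ c → U c ≡ true × L c d) →
       L a d)

  Nontrivial : Subset n → Set
  Nontrivial U =
    (∃₂ λ x y → U x ≡ true × U y ≡ true × ¬ E x y) ×
    (∃₂ λ x y → U x ≡ false × U y ≡ false × ¬ E x y)

  Cross : Subset n → Subset n → Set
  Cross U W =
    (∃ λ x → U x ≡ true × W x ≡ true) ×
    (∃ λ x → U x ≡ true × W x ≡ false) ×
    (∃ λ x → U x ≡ false × W x ≡ true) ×
    (∃ λ x → U x ≡ false × W x ≡ false)

  IsStrongSplit : Subset n → Set
  IsStrongSplit U = IsSplit U × (∀ W → IsSplit W → ¬ Cross U W)

NTStrongSplit : ∀ {n} → Rel n → Subset n → Set
NTStrongSplit A U = IsStrongSplit _≡_ A U × Nontrivial _≡_ A U

-- A node (quotient graph) u of the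
-- split tree is represented by the partition of V(G) induced by u: two
-- vertices are in the same part iff they lie behind the same marker
-- vertex of u (a leaf-node x of u gives the singleton part {x}; a
-- split-node gives the side of the corresponding strong split).

IsEquivB : ∀ {n} → BRel n → Set
IsEquivB R =
  (∀ x → R x x ≡ true) ×
  (∀ x y → R x y ≡ true → R y x ≡ true) ×
  (∀ x y z → R x y ≡ true → R y z ≡ true → R x z ≡ true)

IsNode : ∀ {n} → Rel n → BRel n → Set
IsNode A R =
  IsEquivB R ×
  (∃₂ λ x y → ∃ λ z → R x y ≡ false × R x z ≡ false × R y z ≡ false) ×
  (∀ x → (∃ λ y → y ≢ x × R x y ≡ true) → NTStrongSplit A (R x)) ×
  (∀ U → NTStrongSplit A U →
     ∃ λ x → (∀ y → U y ≡ true → R x y ≡ true) ⊎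
             (∀ y → U y ≡ false → R x y ≡ true))

_≐_ : ∀ {n} → BRel n → BRel n → Set
R ≐ S = ∀ x y → R x y ≡ S x y

-- label (quotient graph) adjacency of node R, on representatives
LAdj : ∀ {n} → Rel n → BRel n → Rel n
LAdj A R x y = R x y ≡ false × ∃₂ λ a b → R x a ≡ true × R y b ≡ true × A a b

Complete : ∀ {n} → Rel n → BRel n → Set
Complete A R = ∀ x y → R x y ≡ false → LAdj A R x y

StarCenter : ∀ {n} → Rel n → BRel n → Fin n → Set
StarCenter A R c =
  (∀ x → R c x ≡ false → LAdj A R c x) ×
  (∀ x y → R c x ≡ false → R c y ≡ false → ¬ LAdj A R x y)

Prime : ∀ {n} → Rel n → BRel n → Set
Prime A R =
  (∀ U → ¬ (IsSplit (λ x y → R x y ≡ true) (LAdj A R) U ×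
            Nontrivial (λ x y → R x y ≡ true) (LAdj A R) U)) ×
  ¬ Complete A R ×
  ¬ (∃ λ c → StarCenter A R c)

data QType : Set where
  starCenter starSpoke complete prime : QType

HasType : ∀ {n} → Rel n → BRel n → Fin n → QType → Set
HasType A R q starCenter = StarCenter A R q
HasType A R q starSpoke  = ∃ λ c → StarCenter A R c × R c q ≡ false
HasType A R q complete   = Complete A R
HasType A R q prime      = Prime A R

-- One-vertex extensions.  The new vertex p is zero : Fin (suc n); an old
-- vertex x is suc x.

data ExtKind : Set where
  pendant falseTwin trueTwin : ExtKind

Ext : ∀ {n} → ExtKind → Fin n → Rel n → Rel (suc n)
Ext k         q L zero    zero    = ⊥
Ext pendant   q L zero    (suc y) = y ≡ q
Ext falseTwin q L zero    (suc y) = L q y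
Ext trueTwin  q L zero    (suc y) = L q y ⊎ y ≡ q
Ext pendant   q L (suc x) zero    = x ≡ q
Ext falseTwin q L (suc x) zero    = L q x
Ext trueTwin  q L (suc x) zero    = L q x ⊎ x ≡ q
Ext k         q L (suc x) (suc y) = L x y

-- partition of V(G') induced by partition R of V(G): p joins the part of q
liftP : ∀ {n} → Fin n → BRel n → BRel (suc n)
liftP q R zero    zero    = true
liftP q R zero    (suc y) = R q y
liftP q R (suc x) zero    = R x q
liftP q R (suc x) (suc y) = R x y

plusP : ∀ {n} → BRel n → BRel (suc n)
plusP R zero    zero    = true
plusP R zero    (suc y) = false
plusP R (suc x) zero    = false
plusP R (suc x) (suc y) = R x y

sameB : Bool → Bool → Bool
sameB true  true  = true
sameB false false = true
sameB _     _     = false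

-- the partition {p} , {q} , V(G) - {q}
pairP : ∀ {n} → Fin n → BRel (suc n)
pairP q zero    zero    = true
pairP q zero    (suc y) = false
pairP q (suc x) zero    = false
pairP q (suc x) (suc y) = sameB ⌊ x Data.Fin.≟ q ⌋ ⌊ y Data.Fin.≟ q ⌋

-- shape of the three-vertex quotient graph Q2' on {p , q , split-node s}
data Shape3 : Set where
  starAtQ     : Shape3
  starAtSplit : Shape3
  triangle    : Shape3

adjPQ adjPS adjQS : Shape3 → Set
adjPQ starAtQ     = ⊤
adjPQ starAtSplit = ⊥
adjPQ triangle    = ⊤
adjPS starAtQ     = ⊥
adjPS starAtSplit = ⊤
adjPS triangle    = ⊤
adjQS starAtQ     = ⊤
adjQS starAtSplit = ⊤
adjQS triangle    = ⊤

data Outcome : Set where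
  single : Outcome            -- Q' = Q with the extension applied inside Q
  two    : Shape3 → Outcome   -- Q' = Q1' ∪ Q2'

expected : QType → ExtKind → Outcome
expected starCenter pendant   = single
expected starCenter falseTwin = two starAtSplit
expected starCenter trueTwin  = two triangle
expected starSpoke  pendant   = two starAtQ
expected starSpoke  falseTwin = single
expected starSpoke  trueTwin  = two triangle
expected complete   pendant   = two starAtQ
expected complete   falseTwin = two starAtSplit
expected complete   trueTwin  = single
expected prime      pendant   = two starAtQ
expected prime      falseTwin = two starAtSplit
expected prime      trueTwin  = two triangle

OldNode : ∀ {n} → Rel n → Fin n → BRel n → BRel (suc n) → Set
OldNode A q Q P = ∃ λ R → IsNode A R × ¬ (R ≐ Q) × P ≐ liftP q R

OldLabels : ∀ {n} → Rel n → ExtKind → Fin n → BRel n → Set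
OldLabels A e q Q = ∀ R → IsNode A R → ¬ (R ≐ Q) →
  ∀ x y → LAdj (Ext e q A) (liftP q R) (suc x) (suc y) ⇔ LAdj A R x y

Q2Is : ∀ {n} → Rel (suc n) → Fin n → Shape3 → Set
Q2Is A' q sh =
  (LAdj A' (pairP q) zero (suc q) ⇔ adjPQ sh) ×
  (∀ y → y ≢ q →
     (LAdj A' (pairP q) zero (suc y) ⇔ adjPS sh) ×
     (LAdj A' (pairP q) (suc q) (suc y) ⇔ adjQS sh))

Result : ∀ {n} → Rel n → Fin n → BRel n → ExtKind → Outcome → Set
Result A q Q e single =
  (∀ P → IsNode (Ext e q A) P ⇔ (OldNode A q Q P ⊎ P ≐ plusP Q)) ×
  OldLabels A e q Q ×
  (∀ x y → LAdj (Ext e q A) (plusP Q) x y ⇔ Ext e q (LAdj A Q) x y)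
Result A q Q e (two sh) =
  (∀ P → IsNode (Ext e q A) P ⇔
           (OldNode A q Q P ⊎ P ≐ liftP q Q ⊎ P ≐ pairP q)) ×
  OldLabels A e q Q ×
  (∀ x y → LAdj (Ext e q A) (liftP q Q) (suc x) (suc y) ⇔ LAdj A Q x y) ×
  Q2Is (Ext e q A) q sh

{-# OPTIONS --safe #-}
module Submission where

-- Since p is a pendant vertex or a twin of q, a split of G lifts to G' by putting p on the side of
-- q, and a nontrivial strong split of G' never separates p from q (it would cross {p , q}). So the
-- nontrivial strong splits of G' are the lifts of those of G, together with {p , q} if that is
-- strong. Hence the old nodes survive with p added to the part of q, and Q is replaced either by Q
-- with the extra part {p} (if {p , q} is not strong) or by Q with p added to the part of q together
-- with the node {p} , {q} , rest (if it is).
-- Now {p , q} is strong exactly when no split of G' separates p from q with old vertices on both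
-- sides. Such a split restricts to splits X and Z of G (with p removed, resp. replaced by q) which
-- are unions of parts of Q. For prime Q they force Q to have exactly three parts, and a connected
-- three-vertex quotient is a star or complete; for stars and complete graphs, the shape of Q decides
-- directly whether such a split exists.

open import Defs
open import Data.Nat using (ℕ; suc; _≤_)
open import Data.Fin using (Fin; zero; suc; _≟_)
open import Data.Fin.Properties using (suc-injective; 0≢1+n; any?)
open import Data.Bool using (Bool; true; false; not)
open import Data.Bool.Properties
  using (not-¬; ¬-not; not-injective; not-involutive; ⇔→≡) renaming (_≟_ to _≟ᵇ_)
open import Data.Product using (∃; ∃₂; _×_; _,_; proj₁; proj₂)
open import Data.Sum using (_⊎_; inj₁; inj₂; [_,_]′)
open import Data.Empty using (⊥; ⊥-elim)
open import Data.Unit using (tt)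
open import Relation.Nullary using (¬_; yes; no; ¬?; _×-dec_)
open import Relation.Nullary.Decidable using (⌊_⌋; toSum; decidable-stable)
open import Relation.Binary.PropositionalEquality
  using (_≡_; _≢_; _≗_; refl; sym; trans; cong; cong₂; subst)
open import Function.Base using (_∘_)
open import Function.Bundles using (_⇔_; mk⇔; Equivalence)
import Data.Product as Product
import Data.Sum as Sum

true-or-false : ∀ b → b ≡ true ⊎ b ≡ false
true-or-false true  = inj₁ refl
true-or-false false = inj₂ refl

isq : ∀ {n} → Fin n → Fin n → Bool
isq q x = ⌊ x ≟ q ⌋

isq-self : ∀ {n} (q : Fin n) → isq q q ≡ true
isq-self q with q ≟ q
... | yes _ = refl
... | no q≢q = ⊥-elim (q≢q refl)

isq-≢ : ∀ {n} {q x : Fin n} → x ≢ q → isq q x ≡ false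
isq-≢ {q = q} {x} x≢q with x ≟ q
... | yes x≡q = ⊥-elim (x≢q x≡q)
... | no _ = refl

isq-true : ∀ {n} {q x : Fin n} → isq q x ≡ true → x ≡ q
isq-true {q = q} {x} h with x ≟ q
... | yes x≡q = x≡q

isq-false : ∀ {n} {q x : Fin n} → isq q x ≡ false → x ≢ q
isq-false {q = q} {x} h with x ≟ q
... | no x≢q = x≢q

≢-avoid : ∀ {n} {x y : Fin n} (v : Fin n) → x ≢ y → x ≢ v ⊎ y ≢ v
≢-avoid {x = x} v x≢y with x ≟ v
... | no x≢v = inj₁ x≢v
... | yes refl = inj₂ (λ y≡x → x≢y (sym y≡x))

sameB-refl : ∀ a → sameB a a ≡ true
sameB-refl true  = refl
sameB-refl false = refl

sameB-≡ : ∀ a b → sameB a b ≡ true → a ≡ b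
sameB-≡ true  true  _ = refl
sameB-≡ false false _ = refl

-- Splits

∁ : ∀ {n} → Subset n → Subset n
∁ U x = not (U x)

FrontiersJoined : ∀ {n} → Rel n → Subset n → Set
FrontiersJoined A U = ∀ a d → U a ≡ true → U d ≡ false →
  (∃ λ b → U b ≡ false × A a b) → (∃ λ c → U c ≡ true × A c d) → A a d

module _ {n : ℕ} {A : Rel n} where

  mkSplit : ∀ {U} → (∃ λ x → U x ≡ true) → (∃ λ y → U y ≡ false) →
            FrontiersJoined A U → IsSplit _≡_ A U
  mkSplit inside outside joined = (λ { x .x refl → refl }) , inside , outside , joined

  split-joined : ∀ {U} → IsSplit _≡_ A U → FrontiersJoined A U
  split-joined (_ , _ , _ , joined) = joined

  Cross-corner : ∀ {U W} → Cross _≡_ A U W → ∀ b c → ∃ λ x → U x ≡ b × W x ≡ c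
  Cross-corner (c₁ , _  , _  , _ ) true  true  = c₁
  Cross-corner (_  , c₂ , _  , _ ) true  false = c₂
  Cross-corner (_  , _  , c₃ , _ ) false true  = c₃
  Cross-corner (_  , _  , _  , c₄) false false = c₄

  mkCross : ∀ {U W} b →
    (∃ λ x → U x ≡ b × W x ≡ true) → (∃ λ x → U x ≡ b × W x ≡ false) →
    (∃ λ x → U x ≡ not b × W x ≡ true) → (∃ λ x → U x ≡ not b × W x ≡ false) →
    Cross _≡_ A U W
  mkCross true  bt bf nt nf = bt , bf , nt , nf
  mkCross false bt bf nt nf = nt , nf , bt , bf

  Cross-∁ˡ : ∀ {U W} → Cross _≡_ A (∁ U) W → Cross _≡_ A U W
  Cross-∁ˡ ((x₁ , u₁ , w₁) , (x₂ , u₂ , w₂) , (x₃ , u₃ , w₃) , (x₄ , u₄ , w₄)) =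
    (x₃ , not-injective u₃ , w₃) , (x₄ , not-injective u₄ , w₄) ,
    (x₁ , not-injective u₁ , w₁) , (x₂ , not-injective u₂ , w₂)

  Cross-∁ʳ : ∀ {U W} → Cross _≡_ A U W → Cross _≡_ A U (∁ W)
  Cross-∁ʳ ((x₁ , u₁ , w₁) , (x₂ , u₂ , w₂) , (x₃ , u₃ , w₃) , (x₄ , u₄ , w₄)) =
    (x₂ , u₂ , cong not w₂) , (x₁ , u₁ , cong not w₁) ,
    (x₄ , u₄ , cong not w₄) , (x₃ , u₃ , cong not w₃)

  Cross-resp : ∀ {U V W} → U ≗ V → Cross _≡_ A U W → Cross _≡_ A V W
  Cross-resp U≗V ((x₁ , u₁ , w₁) , (x₂ , u₂ , w₂) , (x₃ , u₃ , w₃) , (x₄ , u₄ , w₄)) =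
    (x₁ , tr x₁ u₁ , w₁) , (x₂ , tr x₂ u₂ , w₂) , (x₃ , tr x₃ u₃ , w₃) , (x₄ , tr x₄ u₄ , w₄)
    where
    tr : ∀ x {b} → _ ≡ b → _ ≡ b
    tr x = trans (sym (U≗V x))

  IsSplit-resp : ∀ {U V} → U ≗ V → IsSplit _≡_ A U → IsSplit _≡_ A V
  IsSplit-resp {U} {V} U≗V (_ , (x , ux) , (y , uy) , joined) =
    mkSplit (x , to x ux) (y , to y uy)
      (λ a d va vd (b , vb , ab) (c , vc , cd) →
        joined a d (from a va) (from d vd) (b , from b vb , ab) (c , from c vc , cd))
    where
    to : ∀ x {b} → U x ≡ b → V x ≡ b
    to x = trans (sym (U≗V x))
    from : ∀ x {b} → V x ≡ b → U x ≡ b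
    from x = trans (U≗V x)

  Nontrivial-∁ : ∀ {U} → Nontrivial _≡_ A U → Nontrivial _≡_ A (∁ U)
  Nontrivial-∁ ((x , y , ux , uy , x≢y) , (x' , y' , ux' , uy' , x'≢y')) =
    (x' , y' , cong not ux' , cong not uy' , x'≢y') , (x , y , cong not ux , cong not uy , x≢y)

  Nontrivial-resp : ∀ {U V} → U ≗ V → Nontrivial _≡_ A U → Nontrivial _≡_ A V
  Nontrivial-resp U≗V ((x , y , ux , uy , x≢y) , (x' , y' , ux' , uy' , x'≢y')) =
    (x , y , tr x ux , tr y uy , x≢y) , (x' , y' , tr x' ux' , tr y' uy' , x'≢y')
    where
    tr : ∀ x {b} → _ ≡ b → _ ≡ b
    tr x = trans (sym (U≗V x))

  NTStrongSplit-resp : ∀ {U V} → U ≗ V → NTStrongSplit A U → NTStrongSplit A V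
  NTStrongSplit-resp U≗V ((split , strong) , nt) =
    (IsSplit-resp U≗V split , λ W sW cross → strong W sW (Cross-resp (λ x → sym (U≗V x)) cross)) ,
    Nontrivial-resp U≗V nt

  edgeLeaving : ∀ (S : Subset n) {x y} → Path A x y → S x ≡ true → S y ≡ false →
                ∃₂ λ a b → S a ≡ true × S b ≡ false × A a b
  edgeLeaving S (here x) sx sy = ⊥-elim (not-¬ sx sy)
  edgeLeaving S (step {x} {y} xy path) sx sz with S y in sy
  ... | true = edgeLeaving S path sy sz
  ... | false = x , y , sx , sy , xy

path-neighbour : ∀ {n} {A : Rel n} {x y} → Path A x y → x ≢ y → ∃ λ v → A x v
path-neighbour (here _)   x≢x = ⊥-elim (x≢x refl)
path-neighbour (step xv _) _  = _ , xv

module _ {n : ℕ} {A : Rel n} (symA : Symmetric A) where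

  IsSplit-∁ : ∀ {U} → IsSplit _≡_ A U → IsSplit _≡_ A (∁ U)
  IsSplit-∁ (_ , (x , ux) , (y , uy) , joined) =
    mkSplit (y , cong not uy) (x , cong not ux)
      (λ a d ua ud (b , ub , ab) (c , uc , cd) →
        symA d a (joined d a (not-injective ud) (not-injective ua)
                   (c , not-injective uc , symA c d cd) (b , not-injective ub , symA a b ab)))

  NTStrongSplit-∁ : ∀ {U} → NTStrongSplit A U → NTStrongSplit A (∁ U)
  NTStrongSplit-∁ ((split , strong) , nt) =
    (IsSplit-∁ split , λ W sW cross → strong W sW (Cross-∁ˡ {A = A} cross)) , Nontrivial-∁ {A = A} nt

memberAvoiding : ∀ {m} {U : Subset m} {b} v w → U w ≡ not b →
  (∃₂ λ x y → U x ≡ b × U y ≡ b × x ≢ y) → ∃ λ x → x ≢ v × x ≢ w × U x ≡ b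
memberAvoiding {b = b} v w uw (x , y , ux , uy , x≢y) with ≢-avoid v x≢y
... | inj₁ x≢v = x , x≢v , (λ { refl → not-¬ ux uw }) , ux
... | inj₂ y≢v = y , y≢v , (λ { refl → not-¬ uy uw }) , uy

-- Partitions and nodes

IsSingleton : ∀ {n} → BRel n → Fin n → Set
IsSingleton R q = ∀ y → R q y ≡ true → y ≡ q

SideWithinPart : ∀ {n} → BRel n → Subset n → Set
SideWithinPart R U =
  ∃ λ x → (∀ y → U y ≡ true → R x y ≡ true) ⊎ (∀ y → U y ≡ false → R x y ≡ true)

module Partition {n} {R : BRel n} (isEquiv : IsEquivB R) where

  ≈-refl : ∀ x → R x x ≡ true
  ≈-refl = proj₁ isEquiv

  ≈-sym : ∀ {x y} → R x y ≡ true → R y x ≡ true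
  ≈-sym = proj₁ (proj₂ isEquiv) _ _

  ≈-trans : ∀ {x y z} → R x y ≡ true → R y z ≡ true → R x z ≡ true
  ≈-trans = proj₂ (proj₂ isEquiv) _ _ _

  ≉-sym : ∀ {x y} → R x y ≡ false → R y x ≡ false
  ≉-sym xy = ¬-not (λ yx → not-¬ (≈-sym yx) xy)

  ≉-≈-trans : ∀ {x y z} → R x y ≡ false → R y z ≡ true → R x z ≡ false
  ≉-≈-trans xy yz = ¬-not (λ xz → not-¬ (≈-trans xz (≈-sym yz)) xy)

  R-sym : ∀ x y → R x y ≡ R y x
  R-sym x y = ⇔→≡ {z = true} (mk⇔ ≈-sym ≈-sym)

  R-cong : ∀ {x y} → R x y ≡ true → ∀ z → R x z ≡ R y z
  R-cong xy z = ⇔→≡ {z = true} (mk⇔ (≈-trans (≈-sym xy)) (≈-trans xy))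

  singleton-≈ : ∀ {q y} → IsSingleton R q → R y q ≡ true → y ≡ q
  singleton-≈ isolated yq = isolated _ (≈-sym yq)

  singleton-≉ : ∀ {q y} → IsSingleton R q → y ≢ q → R q y ≡ false
  singleton-≉ isolated y≢q = ¬-not (λ qy → y≢q (isolated _ qy))

  cover-¬threeParts : ∀ {x q a b c} → (∀ z → z ≢ q → R x z ≡ true) →
                      R a b ≡ false → R a c ≡ false → R b c ≡ false → ⊥
  cover-¬threeParts {x} {q} {a} {b} {c} covers ab ac bc with toSum (a ≟ q) | toSum (b ≟ q)
  ... | inj₂ a≢q | inj₂ b≢q = not-¬ (≈-trans (≈-sym (covers a a≢q)) (covers b b≢q)) ab
  ... | inj₂ a≢q | inj₁ refl = not-¬ (≈-trans (≈-sym (covers a a≢q)) (covers c c≢a)) ac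
    where
    c≢a : c ≢ b
    c≢a refl = not-¬ (≈-refl c) bc
  ... | inj₁ refl | _ = not-¬ (≈-trans (≈-sym (covers b b≢a)) (covers c c≢a)) bc
    where
    b≢a : b ≢ a
    b≢a refl = not-¬ (≈-refl b) ab
    c≢a : c ≢ a
    c≢a refl = not-¬ (≈-refl c) ac

isolated? : ∀ {n} (R : BRel n) q → IsSingleton R q ⊎ ∃ λ y → y ≢ q × R q y ≡ true
isolated? R q with any? (λ y → ¬? (y ≟ q) ×-dec (R q y ≟ᵇ true))
... | yes other = inj₂ other
... | no none = inj₁ λ y qy → decidable-stable (y ≟ q) (λ y≢q → none (y , y≢q , qy))

module Node {n} {A : Rel n} {R : BRel n} (node : IsNode A R) where
  open Partition (proj₁ node) public

  threeParts : ∃₂ λ x y → ∃ λ z → R x y ≡ false × R x z ≡ false × R y z ≡ false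
  threeParts = proj₁ (proj₂ node)

  part-ntStrong : ∀ x → (∃ λ y → y ≢ x × R x y ≡ true) → NTStrongSplit A (R x)
  part-ntStrong = proj₁ (proj₂ (proj₂ node))

  ntStrong-withinPart : ∀ U → NTStrongSplit A U → SideWithinPart R U
  ntStrong-withinPart = proj₂ (proj₂ (proj₂ node))

  part-split : ∀ {x y} → y ≢ x → R x y ≡ true → IsSplit _≡_ A (R x)
  part-split {x} {y} y≢x xy = proj₁ (proj₁ (part-ntStrong x (y , y≢x , xy)))

  part-noCross : ∀ {x y} → y ≢ x → R x y ≡ true → ∀ W → IsSplit _≡_ A W → ¬ Cross _≡_ A (R x) W
  part-noCross {x} {y} y≢x xy = proj₂ (proj₁ (part-ntStrong x (y , y≢x , xy)))

  part-joined : ∀ v → FrontiersJoined A (R v)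
  part-joined v a d va vd b-out (c , vc , cd) with a ≟ v
  ... | no a≢v = split-joined (part-split a≢v va) a d va vd b-out (c , vc , cd)
  ... | yes refl with c ≟ a
  ...   | yes refl = cd
  ...   | no c≢a = split-joined (part-split c≢a vc) a d va vd b-out (c , vc , cd)

  private
    Meets : Fin n → Fin n → Fin n → Set
    Meets x₁ x₂ v = R x₁ v ≡ true ⊎ R x₂ v ≡ true

    meets? : ∀ x₁ x₂ v → (R x₁ v ≡ false × R x₂ v ≡ false) ⊎ Meets x₁ x₂ v
    meets? x₁ x₂ v with R x₁ v in e₁ | R x₂ v in e₂
    ... | false | false = inj₁ (refl , refl)
    ... | true  | _     = inj₂ (inj₁ refl)
    ... | false | true  = inj₂ (inj₂ refl)

    samePart : ∀ {x u v} → R x u ≡ true → R x v ≡ true → R u v ≡ false → ⊥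
    samePart xu xv uv = not-¬ (≈-trans (≈-sym xu) xv) uv

    pigeonhole : ∀ {x₁ x₂ u v w} → Meets x₁ x₂ u → Meets x₁ x₂ v → Meets x₁ x₂ w →
                 R u v ≡ false → R u w ≡ false → R v w ≡ false → ⊥
    pigeonhole (inj₁ u) (inj₁ v) _        uv uw vw = samePart u v uv
    pigeonhole (inj₂ u) (inj₂ v) _        uv uw vw = samePart u v uv
    pigeonhole (inj₁ u) (inj₂ v) (inj₁ w) uv uw vw = samePart u w uw
    pigeonhole (inj₁ u) (inj₂ v) (inj₂ w) uv uw vw = samePart v w vw
    pigeonhole (inj₂ u) (inj₁ v) (inj₁ w) uv uw vw = samePart v w vw
    pigeonhole (inj₂ u) (inj₁ v) (inj₂ w) uv uw vw = samePart u w uw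

  avoidTwoParts : ∀ x₁ x₂ → ∃ λ w → R x₁ w ≡ false × R x₂ w ≡ false
  avoidTwoParts x₁ x₂ with threeParts
  ... | a , b , c , ab , ac , bc with meets? x₁ x₂ a
  ...   | inj₁ avoids = a , avoids
  ...   | inj₂ ma with meets? x₁ x₂ b
  ...     | inj₁ avoids = b , avoids
  ...     | inj₂ mb with meets? x₁ x₂ c
  ...       | inj₁ avoids = c , avoids
  ...       | inj₂ mc = ⊥-elim (pigeonhole ma mb mc ab ac bc)

  avoidPart : ∀ x → ∃ λ w → R x w ≡ false
  avoidPart x with avoidTwoParts x x
  ... | w , xw , _ = w , xw

plusP-equiv : ∀ {n} {R : BRel n} → IsEquivB R → IsEquivB (plusP R)
plusP-equiv {R = R} isEquiv = reflexive , symmetric , transitive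
  where
  open Partition isEquiv
  reflexive : ∀ x → plusP R x x ≡ true
  reflexive zero    = refl
  reflexive (suc x) = ≈-refl x
  symmetric : ∀ x y → plusP R x y ≡ true → plusP R y x ≡ true
  symmetric zero    zero    _  = refl
  symmetric (suc x) (suc y) xy = ≈-sym xy
  transitive : ∀ x y z → plusP R x y ≡ true → plusP R y z ≡ true → plusP R x z ≡ true
  transitive zero    zero    z       _  yz = yz
  transitive (suc x) (suc y) (suc z) xy yz = ≈-trans xy yz

≐-sym : ∀ {n} {R S : BRel n} → R ≐ S → S ≐ R
≐-sym R≐S x y = sym (R≐S x y)

IsNode-resp : ∀ {n} {A : Rel n} {R S : BRel n} → R ≐ S → IsNode A R → IsNode A S
IsNode-resp {R = R} {S} R≐S node@((_ , _ , _) , (x , y , z , xy , xz , yz) , parts , within) =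
  (to ∘ ≈-refl , (λ x y → to ∘ ≈-sym ∘ from) , (λ x y z xy yz → to (≈-trans (from xy) (from yz)))) ,
  (x , y , z , to xy , to xz , to yz) ,
  (λ x (y , y≢x , xy) → NTStrongSplit-resp (R≐S x) (parts x (y , y≢x , from xy))) ,
  λ U nt → Product.map₂ (Sum.map (λ f y u → to (f y u)) (λ f y u → to (f y u))) (within U nt)
  where
  open Node node
  to : ∀ {x y b} → R x y ≡ b → S x y ≡ b
  to {x} {y} = trans (sym (R≐S x y))
  from : ∀ {x y b} → S x y ≡ b → R x y ≡ b
  from {x} {y} = trans (R≐S x y)

module _ {n} {A : Rel n} {R R' : BRel n} {q} (nR : IsNode A R) (nR' : IsNode A R')
         (sR : IsSingleton R q) (sR' : IsSingleton R' q) where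
  private
    module N = Node nR
    module N' = Node nR'

  node-part-⊆ : ∀ {x y} → R x y ≡ true → R' x y ≡ true
  node-part-⊆ {x} {y} xy with y ≟ x
  ... | yes refl = N'.≈-refl x
  ... | no y≢x with N.part-ntStrong x (y , y≢x , xy)
  ...   | nt@(_ , _ , (a , b , x≉a , x≉b , a≢b)) with N'.ntStrong-withinPart (R x) nt
  ...     | v , inj₁ inside = N'.≈-trans (N'.≈-sym (inside x (N.≈-refl x))) (inside y xy)
  ...     | v , inj₂ outside = ⊥-elim (a≢b (trans (isQ a x≉a) (sym (isQ b x≉b))))
    where
    x≉q : R x q ≡ false
    x≉q = ¬-not (λ xq → y≢x (trans (N.singleton-≈ sR (N.≈-trans (N.≈-sym xy) xq))
                                    (sym (N.singleton-≈ sR xq))))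
    -- the complement of the part of x lies in the part of q in R', which is {q}
    isQ : ∀ z → R x z ≡ false → z ≡ q
    isQ z xz = sR' z (subst (λ v → R' v z ≡ true)
                            (N'.singleton-≈ sR' (outside q x≉q)) (outside z xz))

node-unique : ∀ {n} {A : Rel n} {R R' : BRel n} {q} → IsNode A R → IsNode A R' →
              IsSingleton R q → IsSingleton R' q → R ≐ R'
node-unique nR nR' sR sR' x y =
  ⇔→≡ {z = true} (mk⇔ (node-part-⊆ nR nR' sR sR') (node-part-⊆ nR' nR sR' sR))

-- Quotient graphs

quotientSplit : ∀ {n} {A : Rel n} {R : BRel n} {S : Subset n} →
  (∀ x y → R x y ≡ true → S x ≡ S y) → IsSplit _≡_ A S → IsSplit (λ x y → R x y ≡ true) (LAdj A R) S
quotientSplit {A = A} {R} {S} saturated (_ , inside , outside , joined) =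
  saturated , inside , outside , joined'
  where
  moveTo : ∀ {x x' b} → R x x' ≡ true → S x ≡ b → S x' ≡ b
  moveTo {x} {x'} xx' sx = trans (sym (saturated x x' xx')) sx
  joined' : ∀ a d → S a ≡ true → S d ≡ false → (∃ λ b → S b ≡ false × LAdj A R a b) →
            (∃ λ c → S c ≡ true × LAdj A R c d) → LAdj A R a d
  joined' a d sa sd (b , sb , (_ , a' , b' , aa' , bb' , a'b')) (c , sc , (_ , c' , d' , cc' , dd' , c'd')) =
    ¬-not (λ ad → not-¬ (moveTo ad sa) sd) , a' , d' , aa' , dd' ,
    joined a' d' (moveTo aa' sa) (moveTo dd' sd) (b' , moveTo bb' sb , a'b') (c' , moveTo cc' sc , c'd')

LAdj-sym : ∀ {n} {L : Rel n} {R : BRel n} → Symmetric L → IsEquivB R → Symmetric (LAdj L R)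
LAdj-sym symL isEquiv x y (x≉y , a , b , xa , yb , ab) =
  Partition.≉-sym isEquiv x≉y , b , a , yb , xa , symL a b ab

module ThreeParts {n} {A : Rel n} {R : BRel n} (symA : Symmetric A) (isEquiv : IsEquivB R) where
  open Partition isEquiv

  LAdj-resp : ∀ {u v u' v'} → R u u' ≡ true → R v v' ≡ true → LAdj A R u v → LAdj A R u' v'
  LAdj-resp uu' vv' (u≉v , a , b , ua , vb , ab) =
    ¬-not (λ u'v' → not-¬ (≈-trans (≈-trans uu' u'v') (≈-sym vv')) u≉v) , a , b ,
    ≈-trans (≈-sym uu') ua , ≈-trans (≈-sym vv') vb , ab

  LAdj-swap : ∀ {u v} → LAdj A R u v → LAdj A R v u
  LAdj-swap = LAdj-sym symA isEquiv _ _

  module Centre {a b c} (cover : ∀ v → R a v ≡ true ⊎ R b v ≡ true ⊎ R c v ≡ true)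
                (ab : R a b ≡ false) (ac : R a c ≡ false) (bc : R b c ≡ false) where

    allAdjacent : LAdj A R a b → LAdj A R a c → LAdj A R b c → Complete A R
    allAdjacent Lab Lac Lbc x y x≉y with cover x | cover y
    ... | inj₁ ax        | inj₁ ay        = ⊥-elim (not-¬ (≈-trans (≈-sym ax) ay) x≉y)
    ... | inj₂ (inj₁ bx) | inj₂ (inj₁ by) = ⊥-elim (not-¬ (≈-trans (≈-sym bx) by) x≉y)
    ... | inj₂ (inj₂ cx) | inj₂ (inj₂ cy) = ⊥-elim (not-¬ (≈-trans (≈-sym cx) cy) x≉y)
    ... | inj₁ ax        | inj₂ (inj₁ by) = LAdj-resp ax by Lab
    ... | inj₁ ax        | inj₂ (inj₂ cy) = LAdj-resp ax cy Lac
    ... | inj₂ (inj₁ bx) | inj₁ ay        = LAdj-resp bx ay (LAdj-swap Lab)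
    ... | inj₂ (inj₁ bx) | inj₂ (inj₂ cy) = LAdj-resp bx cy Lbc
    ... | inj₂ (inj₂ cx) | inj₁ ay        = LAdj-resp cx ay (LAdj-swap Lac)
    ... | inj₂ (inj₂ cx) | inj₂ (inj₁ by) = LAdj-resp cx by (LAdj-swap Lbc)

    starAt : LAdj A R a b → LAdj A R a c → ¬ LAdj A R b c → StarCenter A R a
    starAt Lab Lac ¬Lbc = universal , apart
      where
      universal : ∀ x → R a x ≡ false → LAdj A R a x
      universal x a≉x with cover x
      ... | inj₁ ax        = ⊥-elim (not-¬ ax a≉x)
      ... | inj₂ (inj₁ bx) = LAdj-resp (≈-refl a) bx Lab
      ... | inj₂ (inj₂ cx) = LAdj-resp (≈-refl a) cx Lac
      apart : ∀ x y → R a x ≡ false → R a y ≡ false → ¬ LAdj A R x y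
      apart x y a≉x a≉y Lxy@(x≉y , _) with cover x | cover y
      ... | inj₁ ax        | _              = not-¬ ax a≉x
      ... | _              | inj₁ ay        = not-¬ ay a≉y
      ... | inj₂ (inj₁ bx) | inj₂ (inj₁ by) = not-¬ (≈-trans (≈-sym bx) by) x≉y
      ... | inj₂ (inj₂ cx) | inj₂ (inj₂ cy) = not-¬ (≈-trans (≈-sym cx) cy) x≉y
      ... | inj₂ (inj₁ bx) | inj₂ (inj₂ cy) = ¬Lbc (LAdj-resp (≈-sym bx) (≈-sym cy) Lxy)
      ... | inj₂ (inj₂ cx) | inj₂ (inj₁ by) = ¬Lbc (LAdj-resp (≈-sym by) (≈-sym cx) (LAdj-swap Lxy))

    -- adjacency of b and c is not decidable, but a star at a fails only if the quotient is complete
    centre : ¬ Complete A R → ¬ (∃ λ m → StarCenter A R m) → LAdj A R a b → LAdj A R a c → ⊥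
    centre ¬complete ¬star Lab Lac = ¬star (a , starAt Lab Lac (¬complete ∘ allAdjacent Lab Lac))

    neighbourPart : Connected A → LAdj A R a b ⊎ LAdj A R a c
    neighbourPart conn with edgeLeaving (R a) (conn a b) (≈-refl a) ab
    ... | u , v , au , a≉v , uv with cover v
    ...   | inj₁ av        = ⊥-elim (not-¬ av a≉v)
    ...   | inj₂ (inj₁ bv) = inj₁ (ab , u , v , au , bv , uv)
    ...   | inj₂ (inj₂ cv) = inj₂ (ac , u , v , au , cv , uv)

  module _ {a b c} (cover : ∀ v → R a v ≡ true ⊎ R b v ≡ true ⊎ R c v ≡ true)
           (ab : R a b ≡ false) (ac : R a c ≡ false) (bc : R b c ≡ false) where
    private
      module AtA = Centre cover ab ac bc
      module AtB = Centre (λ v → [ inj₂ ∘ inj₁ , [ inj₁ , inj₂ ∘ inj₂ ]′ ]′ (cover v)) (≉-sym ab) bc ac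
      module AtC = Centre (λ v → [ inj₂ ∘ inj₁ , [ inj₂ ∘ inj₂ , inj₁ ]′ ]′ (cover v)) (≉-sym ac) (≉-sym bc) ab

    -- every part has a neighbour part, so some part is adjacent to both others
    connected-three-¬prime : Connected A → ¬ Complete A R → ¬ (∃ λ m → StarCenter A R m) → ⊥
    connected-three-¬prime conn ¬complete ¬star
      with AtA.neighbourPart conn | AtB.neighbourPart conn | AtC.neighbourPart conn
    ... | inj₁ Lab | _        | inj₁ Lca = AtA.centre ¬complete ¬star Lab (LAdj-swap Lca)
    ... | inj₁ Lab | _        | inj₂ Lcb = AtB.centre ¬complete ¬star (LAdj-swap Lab) (LAdj-swap Lcb)
    ... | inj₂ Lac | inj₁ Lba | _        = AtA.centre ¬complete ¬star (LAdj-swap Lba) Lac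
    ... | inj₂ Lac | inj₂ Lbc | _        = AtC.centre ¬complete ¬star (LAdj-swap Lac) (LAdj-swap Lbc)

-- The extended graph G'

Ext-suc⁻ : ∀ e {n} {q} {L : Rel n} {x y} → Ext e q L (suc x) (suc y) → L x y
Ext-suc⁻ pendant   xy = xy
Ext-suc⁻ falseTwin xy = xy
Ext-suc⁻ trueTwin  xy = xy

Ext-suc⁺ : ∀ e {n} {q} {L : Rel n} {x y} → L x y → Ext e q L (suc x) (suc y)
Ext-suc⁺ pendant   xy = xy
Ext-suc⁺ falseTwin xy = xy
Ext-suc⁺ trueTwin  xy = xy

Ext-sym : ∀ e {n} {q} {L : Rel n} → Symmetric L → Symmetric (Ext e q L)
Ext-sym e         symL zero    zero    ()
Ext-sym pendant   symL zero    (suc y) py = py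
Ext-sym falseTwin symL zero    (suc y) py = py
Ext-sym trueTwin  symL zero    (suc y) py = py
Ext-sym pendant   symL (suc x) zero    xp = xp
Ext-sym falseTwin symL (suc x) zero    xp = xp
Ext-sym trueTwin  symL (suc x) zero    xp = xp
Ext-sym e         symL (suc x) (suc y) xy = Ext-suc⁺ e (symL x y (Ext-suc⁻ e xy))

IsTwin : ExtKind → Set
IsTwin e = e ≢ pendant

pendant-or-twin : ∀ e → e ≡ pendant ⊎ IsTwin e
pendant-or-twin pendant   = inj₁ refl
pendant-or-twin falseTwin = inj₂ λ ()
pendant-or-twin trueTwin  = inj₂ λ ()

shapeOf : ExtKind → Shape3
shapeOf pendant   = starAtQ
shapeOf falseTwin = starAtSplit
shapeOf trueTwin  = triangle

module Extension {n} (A : Rel n) (symA : Symmetric A) (irrA : Irreflexive A) (q : Fin n) where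

  A' : ExtKind → Rel (suc n)
  A' e = Ext e q A

  A'-sym : ∀ e → Symmetric (A' e)
  A'-sym e = Ext-sym e symA

  A'-irrefl : ∀ e → Irreflexive (A' e)
  A'-irrefl e zero    ()
  A'-irrefl e (suc x) xx = irrA x (Ext-suc⁻ e xx)

  p-edge⁻ : ∀ e {y} → y ≢ q → A' e zero (suc y) → IsTwin e × A q y
  p-edge⁻ pendant   y≢q y≡q          = ⊥-elim (y≢q y≡q)
  p-edge⁻ falseTwin y≢q qy           = (λ ()) , qy
  p-edge⁻ trueTwin  y≢q (inj₁ qy)    = (λ ()) , qy
  p-edge⁻ trueTwin  y≢q (inj₂ y≡q)   = ⊥-elim (y≢q y≡q)

  p-edge⁺ : ∀ e {y} → IsTwin e → A q y → A' e zero (suc y)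
  p-edge⁺ pendant   twin qy = ⊥-elim (twin refl)
  p-edge⁺ falseTwin twin qy = qy
  p-edge⁺ trueTwin  twin qy = inj₁ qy

  A-≢ : ∀ {x y} → A x y → x ≢ y
  A-≢ {x} xy refl = irrA x xy

  liftS : Subset n → Subset (suc n)
  liftS W zero    = W q
  liftS W (suc y) = W y

  restrict : Subset (suc n) → Subset n
  restrict U y = U (suc y)

  oldNeighbour : ∀ e W x {y b} → liftS W x ≡ b → W y ≡ not b → A' e x (suc y) →
                 ∃ λ x' → W x' ≡ b × A x' y
  oldNeighbour e W zero {y} wq wy py with y ≟ q
  ... | yes refl = ⊥-elim (not-¬ wq wy)
  ... | no y≢q = q , wq , proj₂ (p-edge⁻ e y≢q py)
  oldNeighbour e W (suc x) wx wy xy = x , wx , Ext-suc⁻ e xy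

  oldNeighbourʳ : ∀ e W x {y b} → liftS W x ≡ b → W y ≡ not b → A' e (suc y) x →
                  ∃ λ x' → W x' ≡ b × A y x'
  oldNeighbourʳ e W x {y} wx wy yx =
    Product.map₂ (Product.map₂ (symA _ y)) (oldNeighbour e W x wx wy (A'-sym e (suc y) x yx))

  liftS-joined : ∀ e W → FrontiersJoined A W → FrontiersJoined (A' e) (liftS W)
  liftS-joined e W joined zero zero wq ¬wq _ _ = ⊥-elim (not-¬ wq ¬wq)
  liftS-joined e W joined zero (suc d) wq wd (zero , ¬wq , _) _ = ⊥-elim (not-¬ wq ¬wq)
  liftS-joined e W joined zero (suc d) wq wd (suc b , wb , pb) (c , wc , cd) =
    p-edge⁺ e twin (joined q d wq wd (b , wb , qb) (oldNeighbour e W c wc wd cd))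
    where
    b≢q : b ≢ q
    b≢q refl = not-¬ wq wb
    twin = proj₁ (p-edge⁻ e b≢q pb)
    qb = proj₂ (p-edge⁻ e b≢q pb)
  liftS-joined e W joined (suc a) zero wa ¬wq _ (zero , wq , _) = ⊥-elim (not-¬ wq ¬wq)
  liftS-joined e W joined (suc a) zero wa ¬wq (b , wb , ab) (suc c , wc , cp) =
    A'-sym e zero (suc a)
      (p-edge⁺ e twin (symA a q (joined a q wa ¬wq
        (oldNeighbourʳ e W b wb wa ab) (c , wc , symA q c qc))))
    where
    c≢q : c ≢ q
    c≢q refl = not-¬ wc ¬wq
    twin = proj₁ (p-edge⁻ e c≢q (A'-sym e (suc c) zero cp))
    qc = proj₂ (p-edge⁻ e c≢q (A'-sym e (suc c) zero cp))
  liftS-joined e W joined (suc a) (suc d) wa wd (b , wb , ab) (c , wc , cd) =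
    Ext-suc⁺ e (joined a d wa wd
      (oldNeighbourʳ e W b wb wa ab)
      (oldNeighbour e W c wc wd cd))

  liftS-split : ∀ e {W} → IsSplit _≡_ A W → IsSplit _≡_ (A' e) (liftS W)
  liftS-split e {W} (_ , (x , wx) , (y , wy) , joined) =
    mkSplit (suc x , wx) (suc y , wy) (liftS-joined e W joined)

  restrict-split : ∀ e {U} → IsSplit _≡_ (A' e) U →
    (∃ λ x → U (suc x) ≡ true) → (∃ λ y → U (suc y) ≡ false) → IsSplit _≡_ A (restrict U)
  restrict-split e split inside outside =
    mkSplit inside outside (λ a d ua ud (b , ub , ab) (c , uc , cd) →
      Ext-suc⁻ e (split-joined split (suc a) (suc d) ua ud
                   (suc b , ub , Ext-suc⁺ e ab) (suc c , uc , Ext-suc⁺ e cd)))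

  PQ : Subset (suc n)
  PQ zero    = true
  PQ (suc y) = isq q y

  PQ-neighbour : ∀ e c {d} → PQ c ≡ true → d ≢ q → A' e c (suc d) → A q d
  PQ-neighbour e zero _  d≢q pd = proj₂ (p-edge⁻ e d≢q pd)
  PQ-neighbour e (suc c) {d} cq d≢q cd = subst (λ c → A c d) (isq-true cq) (Ext-suc⁻ e cd)

  PQ-joined : ∀ e → FrontiersJoined (A' e) PQ
  PQ-joined e a zero _ () _ _
  PQ-joined e zero (suc d) _ dq (zero , () , _) _
  PQ-joined e zero (suc d) _ dq (suc b , bq , pb) (c , cq , cd) =
    p-edge⁺ e (proj₁ (p-edge⁻ e (isq-false bq) pb)) (PQ-neighbour e c cq (isq-false dq) cd)
  PQ-joined e (suc a) (suc d) aq dq _ (c , cq , cd) =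
    Ext-suc⁺ e (subst (λ a → A a d) (sym (isq-true aq)) (PQ-neighbour e c cq (isq-false dq) cd))

  PQ-split : ∀ e {w} → w ≢ q → IsSplit _≡_ (A' e) PQ
  PQ-split e w≢q = mkSplit (zero , refl) (_ , isq-≢ w≢q) (PQ-joined e)

  withQ : Subset (suc n) → Subset n
  withQ U x with x ≟ q
  ... | yes _ = true
  ... | no _  = U (suc x)

  withQ-q : ∀ U → withQ U q ≡ true
  withQ-q U with q ≟ q
  ... | yes _ = refl
  ... | no q≢q = ⊥-elim (q≢q refl)

  withQ-≢ : ∀ U {x} → x ≢ q → withQ U x ≡ U (suc x)
  withQ-≢ U {x} x≢q with x ≟ q
  ... | yes x≡q = ⊥-elim (x≢q x≡q)
  ... | no _ = refl

  withQ-false : ∀ U {x} → withQ U x ≡ false → x ≢ q × U (suc x) ≡ false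
  withQ-false U {x} h with x ≟ q
  ... | no x≢q = x≢q , h

  withQ-true : ∀ U {x} → withQ U x ≡ true → x ≢ q → U (suc x) ≡ true
  withQ-true U zx x≢q = trans (sym (withQ-≢ U x≢q)) zx

  pendant-frontier : ∀ {U} → FrontiersJoined (A' pendant) U → U zero ≡ true → U (suc q) ≡ false →
                     ∀ {x z} → U (suc x) ≡ true → U (suc z) ≡ false → A x z → z ≡ q
  pendant-frontier joined p∈U q∉U {x} {z} ux uz xz =
    joined zero (suc z) p∈U uz (suc q , q∉U , refl) (suc x , ux , xz)

  withQ-joined : ∀ e {U} → FrontiersJoined (A' e) U → U zero ≡ true → U (suc q) ≡ false →
                 FrontiersJoined A (withQ U)
  withQ-joined e {U} joined p∈U q∉U a d za zd (b , zb , ab) (c , zc , cd)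
    with withQ-false U zd | withQ-false U zb | pendant-or-twin e
  ... | d≢q , ud | b≢q , ub | inj₁ refl = pendantCase
    where
    pendantCase : A a d
    pendantCase with toSum (a ≟ q) | toSum (c ≟ q)
    ... | inj₂ a≢q | _ = ⊥-elim (b≢q (pendant-frontier joined p∈U q∉U (withQ-true U za a≢q) ub ab))
    ... | inj₁ refl | inj₁ refl = cd
    ... | inj₁ refl | inj₂ c≢q = ⊥-elim (d≢q (pendant-frontier joined p∈U q∉U (withQ-true U zc c≢q) ud cd))
  ... | d≢q , ud | b≢q , ub | inj₂ twin = twinCase
    where
    c-witness : ∃ λ c' → U c' ≡ true × A' e c' (suc d)
    c-witness with toSum (c ≟ q)
    ... | inj₁ refl = zero , p∈U , p-edge⁺ e twin cd
    ... | inj₂ c≢q = suc c , withQ-true U zc c≢q , Ext-suc⁺ e cd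
    twinCase : A a d
    twinCase with toSum (a ≟ q)
    ... | inj₁ refl = proj₂ (p-edge⁻ e d≢q
                       (joined zero (suc d) p∈U ud (suc b , ub , p-edge⁺ e twin ab) c-witness))
    ... | inj₂ a≢q = Ext-suc⁻ e (joined (suc a) (suc d) (withQ-true U za a≢q) ud
                                (suc b , ub , Ext-suc⁺ e ab) c-witness)

  withQ-split : ∀ e {U} → IsSplit _≡_ (A' e) U → U zero ≡ true → U (suc q) ≡ false →
                ∀ {w} → w ≢ q → U (suc w) ≡ false → IsSplit _≡_ A (withQ U)
  withQ-split e {U} split p∈U q∉U {w} w≢q w∉U =
    mkSplit (q , withQ-q U) (w , trans (withQ-≢ U w≢q) w∉U)
            (withQ-joined e (split-joined split) p∈U q∉U)

  liftS-corner : ∀ {W : Subset n} {U : Subset (suc n)} {b₁ b₂} → U zero ≡ U (suc q) →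
    (∃ λ x → liftS W x ≡ b₁ × U x ≡ b₂) → ∃ λ x → W x ≡ b₁ × restrict U x ≡ b₂
  liftS-corner p∼q (zero  , wq , up) = q , wq , trans (sym p∼q) up
  liftS-corner p∼q (suc x , wx , ux) = x , wx , ux

  -- a split U of G' crossing the lift of W yields a split of G crossing W: restrict U or withQ U
  module LiftCross e {W} (strong : ∀ V → IsSplit _≡_ A V → ¬ Cross _≡_ A W V)
                   {U} (sU : IsSplit _≡_ (A' e) U) (p∈U : U zero ≡ true)
                   (cross : Cross _≡_ (A' e) (liftS W) U) where

    q∈U-⊥ : U (suc q) ≡ true → ⊥
    q∈U-⊥ q∈U =
      strong (restrict U) (restrict-split e sU (_ , proj₂ (proj₂ (corner true true)))
                                              (_ , proj₂ (proj₂ (corner true false))))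
             (corner true true , corner true false , corner false true , corner false false)
      where
      corner : ∀ b₁ b₂ → ∃ λ x → W x ≡ b₁ × restrict U x ≡ b₂
      corner b₁ b₂ = liftS-corner (trans p∈U (sym q∈U)) (Cross-corner {A = A' e} cross b₁ b₂)

    oppositeQ : ∀ {b} → (∃ λ x → liftS W x ≡ not (W q) × U x ≡ b) →
                ∃ λ x → x ≢ q × W x ≡ not (W q) × U (suc x) ≡ b
    oppositeQ (zero  , wq , _)  = ⊥-elim (not-¬ refl wq)
    oppositeQ (suc x , wx , ux) = x , (λ { refl → not-¬ refl wx }) , wx , ux

    q∉U-⊥ : ∀ {w} → w ≢ q → W w ≡ W q → U (suc q) ≡ false → ⊥
    q∉U-⊥ {w} w≢q ww q∉U
      with oppositeQ (Cross-corner {A = A' e} cross (not (W q)) true)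
         | oppositeQ (Cross-corner {A = A' e} cross (not (W q)) false)
    ... | x , _ , wx , ux | y , y≢q , wy , uy = [ viaRestrict , viaWithQ ]′ (true-or-false (U (suc w)))
      where
      viaRestrict : U (suc w) ≡ true → ⊥
      viaRestrict w∈U = strong (restrict U) (restrict-split e sU (w , w∈U) (q , q∉U))
        (mkCross {A = A} (W q) (w , ww , w∈U) (q , refl , q∉U) (x , wx , ux) (y , wy , uy))
      withQ-old : ∀ x → U (suc x) ≡ true → withQ U x ≡ true
      withQ-old x ux with toSum (x ≟ q)
      ... | inj₁ refl = withQ-q U
      ... | inj₂ x≢q  = trans (withQ-≢ U x≢q) ux
      viaWithQ : U (suc w) ≡ false → ⊥
      viaWithQ w∉U = strong (withQ U) (withQ-split e sU p∈U q∉U w≢q w∉U)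
        (mkCross {A = A} (W q) (q , refl , withQ-q U) (w , ww , trans (withQ-≢ U w≢q) w∉U)
                 (x , wx , withQ-old x ux) (y , wy , trans (withQ-≢ U y≢q) uy))

  liftS-ntStrong : ∀ e {W} → NTStrongSplit A W → NTStrongSplit (A' e) (liftS W)
  liftS-ntStrong e {W} ((split , strong) , ((x , y , wx , wy , x≢y) , (x' , y' , wx' , wy' , x'≢y'))) =
    (liftS-split e split , liftStrong) ,
    ((suc x , suc y , wx , wy , x≢y ∘ suc-injective) , (suc x' , suc y' , wx' , wy' , x'≢y' ∘ suc-injective))
    where
    sameSideAsQ : ∃ λ w → w ≢ q × W w ≡ W q
    sameSideAsQ with W q in wq | ≢-avoid q x≢y | ≢-avoid q x'≢y'
    ... | true  | inj₁ x≢q | _ = x , x≢q , wx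
    ... | true  | inj₂ y≢q | _ = y , y≢q , wy
    ... | false | _ | inj₁ x'≢q = x' , x'≢q , wx'
    ... | false | _ | inj₂ y'≢q = y' , y'≢q , wy'

    noCross-p∈ : ∀ U → IsSplit _≡_ (A' e) U → U zero ≡ true → ¬ Cross _≡_ (A' e) (liftS W) U
    noCross-p∈ U sU p∈U cross with true-or-false (U (suc q)) | sameSideAsQ
    ... | inj₁ q∈U | _             = LiftCross.q∈U-⊥ e strong sU p∈U cross q∈U
    ... | inj₂ q∉U | w , w≢q , ww = LiftCross.q∉U-⊥ e strong sU p∈U cross w≢q ww q∉U

    liftStrong : ∀ U → IsSplit _≡_ (A' e) U → ¬ Cross _≡_ (A' e) (liftS W) U
    liftStrong U sU cross with true-or-false (U zero)
    ... | inj₁ p∈U = noCross-p∈ U sU p∈U cross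
    ... | inj₂ p∉U = noCross-p∈ (∁ U) (IsSplit-∁ (A'-sym e) sU) (cong not p∉U) (Cross-∁ʳ {A = A' e} cross)

  oldMember : ∀ {U : Subset (suc n)} {b} x → x ≢ zero → x ≢ suc q → U x ≡ b →
              ∃ λ z → z ≢ q × U (suc z) ≡ b
  oldMember zero    x≢0 _   _  = ⊥-elim (x≢0 refl)
  oldMember (suc z) _   x≢q ux = z , x≢q ∘ cong suc , ux

  -- a nontrivial strong split separating p from q would cross {p , q}
  ntStrong-separates-⊥ : ∀ e {U} → NTStrongSplit (A' e) U → U zero ≡ true → U (suc q) ≡ false → ⊥
  ntStrong-separates-⊥ e {U} ((_ , strong) , (inside , outside)) p∈U q∉U
    with memberAvoiding zero (suc q) q∉U inside | memberAvoiding (suc q) zero p∈U outside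
  ... | x , x≢0 , x≢q , ux | y , y≢q , y≢0 , uy
    with oldMember {U = U} x x≢0 x≢q ux | oldMember {U = U} y y≢0 y≢q uy
  ... | x' , x'≢q , ux' | y' , y'≢q , uy' =
    strong PQ (PQ-split e y'≢q)
      ((zero , p∈U , refl) , (suc x' , ux' , isq-≢ x'≢q) ,
       (suc q , q∉U , isq-self q) , (suc y' , uy' , isq-≢ y'≢q))

  ntStrong-sameSide : ∀ e {U} → NTStrongSplit (A' e) U → U zero ≡ U (suc q)
  ntStrong-sameSide e {U} nt with U zero in up | U (suc q) in uq
  ... | true  | true  = refl
  ... | false | false = refl
  ... | true  | false = ⊥-elim (ntStrong-separates-⊥ e nt up uq)
  ... | false | true  =
    ⊥-elim (ntStrong-separates-⊥ e (NTStrongSplit-∁ (A'-sym e) nt) (cong not up) (cong not uq))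

  IsPQSide : Subset (suc n) → Set
  IsPQSide U = ∀ y → U (suc y) ≡ U zero → y ≡ q

  ntStrong-restrict : ∀ e {U} → NTStrongSplit (A' e) U → U zero ≡ true →
                      ∀ {y} → y ≢ q → U (suc y) ≡ true → NTStrongSplit A (restrict U)
  ntStrong-restrict e {U} nt@((split , strong) , (_ , outside)) p∈U {y} y≢q uy =
    (restrict-split e split (q , q∈U) (_ , proj₁ (proj₂ (proj₂ outsideOld))) , restrictStrong) ,
    ((q , y , q∈U , uy , y≢q ∘ sym) , outsideOld)
    where
    q∈U : U (suc q) ≡ true
    q∈U = trans (sym (ntStrong-sameSide e nt)) p∈U

    toOld : (∃₂ λ x x' → U x ≡ false × U x' ≡ false × x ≢ x') →
            ∃₂ λ z z' → U (suc z) ≡ false × U (suc z') ≡ false × z ≢ z'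
    toOld (zero , _ , u0 , _) = ⊥-elim (not-¬ p∈U u0)
    toOld (suc z , zero , _ , u0 , _) = ⊥-elim (not-¬ p∈U u0)
    toOld (suc z , suc z' , uz , uz' , z≢z') = z , z' , uz , uz' , z≢z' ∘ cong suc

    outsideOld = toOld outside

    restrictStrong : ∀ W → IsSplit _≡_ A W → ¬ Cross _≡_ A (restrict U) W
    restrictStrong W sW ((x₁ , u₁ , w₁) , (x₂ , u₂ , w₂) , (x₃ , u₃ , w₃) , (x₄ , u₄ , w₄)) =
      strong (liftS W) (liftS-split e sW)
        ((suc x₁ , u₁ , w₁) , (suc x₂ , u₂ , w₂) , (suc x₃ , u₃ , w₃) , (suc x₄ , u₄ , w₄))

  ntStrong-classify-p∈ : ∀ e {U} → NTStrongSplit (A' e) U → U zero ≡ true →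
                         NTStrongSplit A (restrict U) ⊎ IsPQSide U
  ntStrong-classify-p∈ e {U} nt p∈U with any? (λ y → ¬? (y ≟ q) ×-dec (U (suc y) ≟ᵇ true))
  ... | yes (y , y≢q , uy) = inj₁ (ntStrong-restrict e nt p∈U y≢q uy)
  ... | no none = inj₂ λ y uy → decidable-stable (y ≟ q) (λ y≢q → none (y , y≢q , trans uy p∈U))

  ntStrong-classify : ∀ e {U} → NTStrongSplit (A' e) U → NTStrongSplit A (restrict U) ⊎ IsPQSide U
  ntStrong-classify e {U} nt with true-or-false (U zero)
  ... | inj₁ p∈U = ntStrong-classify-p∈ e nt p∈U
  ... | inj₂ p∉U =
    Sum.map (NTStrongSplit-resp (not-involutive ∘ U ∘ suc) ∘ NTStrongSplit-∁ symA)
            (λ pqSide y eq → pqSide y (cong not eq))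
            (ntStrong-classify-p∈ e (NTStrongSplit-∁ (A'-sym e) nt) (cong not p∉U))

  -- Partitions of V(G') induced by partitions of V(G)

  liftP-equiv : ∀ {R} → IsEquivB R → IsEquivB (liftP q R)
  liftP-equiv {R} isEquiv = reflexive , symmetric , transitive
    where
    open Partition isEquiv
    reflexive : ∀ x → liftP q R x x ≡ true
    reflexive zero    = refl
    reflexive (suc x) = ≈-refl x
    symmetric : ∀ x y → liftP q R x y ≡ true → liftP q R y x ≡ true
    symmetric zero    zero    _  = refl
    symmetric zero    (suc y) xy = ≈-sym xy
    symmetric (suc x) zero    xy = ≈-sym xy
    symmetric (suc x) (suc y) xy = ≈-sym xy
    transitive : ∀ x y z → liftP q R x y ≡ true → liftP q R y z ≡ true → liftP q R x z ≡ true
    transitive zero    zero    z       _  yz = yz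
    transitive zero    (suc y) zero    _  _  = refl
    transitive (suc x) zero    zero    xy _  = xy
    transitive zero    (suc y) (suc z) xy yz = ≈-trans xy yz
    transitive (suc x) zero    (suc z) xy yz = ≈-trans xy yz
    transitive (suc x) (suc y) zero    xy yz = ≈-trans xy yz
    transitive (suc x) (suc y) (suc z) xy yz = ≈-trans xy yz

  liftP-resp : ∀ {R S} → R ≐ S → liftP q R ≐ liftP q S
  liftP-resp R≐S zero    zero    = refl
  liftP-resp R≐S zero    (suc y) = R≐S q y
  liftP-resp R≐S (suc x) zero    = R≐S x q
  liftP-resp R≐S (suc x) (suc y) = R≐S x y

  liftP-node : ∀ e {R} → IsNode A R → NTStrongSplit (A' e) (liftP q R zero) → IsNode (A' e) (liftP q R)
  liftP-node e {R} nR pPart = liftP-equiv (proj₁ nR) , three , parts , within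
    where
    module N = Node nR

    three : ∃₂ λ x y → ∃ λ z →
      liftP q R x y ≡ false × liftP q R x z ≡ false × liftP q R y z ≡ false
    three with N.threeParts
    ... | x , y , z , xy , xz , yz = suc x , suc y , suc z , xy , xz , yz

    parts : ∀ x → (∃ λ y → y ≢ x × liftP q R x y ≡ true) → NTStrongSplit (A' e) (liftP q R x)
    parts zero    _ = pPart
    parts (suc x) (y , y≢x , xy) with true-or-false (R x q)
    ... | inj₁ x≈q = NTStrongSplit-resp samePart pPart
      where
      samePart : liftP q R zero ≗ liftP q R (suc x)
      samePart zero    = sym x≈q
      samePart (suc y) = N.R-cong (N.≈-sym x≈q) y
    ... | inj₂ x≉q = NTStrongSplit-resp liftS≗liftP (liftS-ntStrong e (N.part-ntStrong x (old y y≢x xy)))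
      where
      old : ∀ y → y ≢ suc x → liftP q R (suc x) y ≡ true → ∃ λ y' → y' ≢ x × R x y' ≡ true
      old zero    _   x≈q = ⊥-elim (not-¬ x≈q x≉q)
      old (suc y) y≢x xy  = y , y≢x ∘ cong suc , xy
      liftS≗liftP : liftS (R x) ≗ liftP q R (suc x)
      liftS≗liftP zero    = refl
      liftS≗liftP (suc y) = refl

    liftWithin : ∀ {U : Subset (suc n)} → U zero ≡ U (suc q) →
                 ∀ {x b} → (∀ y → U (suc y) ≡ b → R x y ≡ true) →
                 ∀ y → U y ≡ b → liftP q R (suc x) y ≡ true
    liftWithin p∼q f zero    up = f q (trans (sym p∼q) up)
    liftWithin p∼q f (suc y) uy = f y uy

    within : ∀ U → NTStrongSplit (A' e) U → SideWithinPart (liftP q R) U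
    within U nt with ntStrong-classify e nt
    ... | inj₁ old with N.ntStrong-withinPart (restrict U) old
    ...   | x , inside⊎outside =
      suc x , Sum.map (liftWithin p∼q) (liftWithin p∼q) inside⊎outside
      where
      p∼q = ntStrong-sameSide e nt
    within U nt | inj₂ pqSide = zero , Sum.map pSide pSide (true-or-false (U zero))
      where
      pSide : ∀ {b} → U zero ≡ b → ∀ y → U y ≡ b → liftP q R zero y ≡ true
      pSide up zero    _  = refl
      pSide up (suc y) uy = subst (λ y → R q y ≡ true) (sym (pqSide y (trans uy (sym up)))) (N.≈-refl q)

  pairP-q-q : pairP q (suc q) (suc q) ≡ true
  pairP-q-q = sameB-refl (isq q q)

  pairP-old-old : ∀ {x y} → x ≢ q → y ≢ q → pairP q (suc x) (suc y) ≡ true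
  pairP-old-old x≢q y≢q = trans (cong₂ sameB (isq-≢ x≢q) (isq-≢ y≢q)) refl

  pairP-q-old : ∀ {y} → y ≢ q → pairP q (suc q) (suc y) ≡ false
  pairP-q-old y≢q = trans (cong₂ sameB (isq-self q) (isq-≢ y≢q)) refl

  pairP-old-q : ∀ {x} → x ≢ q → pairP q (suc x) (suc q) ≡ false
  pairP-old-q x≢q = trans (cong₂ sameB (isq-≢ x≢q) (isq-self q)) refl

  pairP-sameClass : ∀ {x y} → pairP q (suc x) (suc y) ≡ true → isq q x ≡ isq q y
  pairP-sameClass {x} {y} = sameB-≡ (isq q x) (isq q y)

  pairP-equiv : IsEquivB (pairP q)
  pairP-equiv = reflexive , symmetric , transitive
    where
    reflexive : ∀ x → pairP q x x ≡ true
    reflexive zero    = refl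
    reflexive (suc x) = sameB-refl (isq q x)
    symmetric : ∀ x y → pairP q x y ≡ true → pairP q y x ≡ true
    symmetric zero    zero    _  = refl
    symmetric (suc x) (suc y) xy =
      subst (λ b → sameB b (isq q x) ≡ true) (pairP-sameClass xy) (sameB-refl (isq q x))
    transitive : ∀ x y z → pairP q x y ≡ true → pairP q y z ≡ true → pairP q x z ≡ true
    transitive zero    zero    z       _  yz = yz
    transitive (suc x) (suc y) (suc z) xy yz =
      subst (λ b → sameB (isq q x) b ≡ true) (trans (pairP-sameClass xy) (pairP-sameClass yz))
            (sameB-refl (isq q x))

  liftP-LAdj : ∀ e {R} → IsEquivB R → ∀ x y →
               LAdj (A' e) (liftP q R) (suc x) (suc y) ⇔ LAdj A R x y
  liftP-LAdj e {R} isEquiv x y = mk⇔ to from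
    where
    open Partition isEquiv
    to : LAdj (A' e) (liftP q R) (suc x) (suc y) → LAdj A R x y
    to (x≉y , zero  , zero  , _  , _  , pp) = ⊥-elim (A'-irrefl e zero pp)
    to (x≉y , suc a , suc b , xa , yb , ab) = x≉y , a , b , xa , yb , Ext-suc⁻ e ab
    to (x≉y , zero  , suc b , xq , yb , pb) = x≉y , q , b , xq , yb , proj₂ (p-edge⁻ e b≢q pb)
      where
      b≢q : b ≢ q
      b≢q refl = not-¬ (≈-trans xq (≈-sym yb)) x≉y
    to (x≉y , suc a , zero  , xa , yq , ap) =
      x≉y , a , q , xa , yq , symA q a (proj₂ (p-edge⁻ e a≢q (A'-sym e (suc a) zero ap)))
      where
      a≢q : a ≢ q
      a≢q refl = not-¬ (≈-trans xa (≈-sym yq)) x≉y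
    from : LAdj A R x y → LAdj (A' e) (liftP q R) (suc x) (suc y)
    from (x≉y , a , b , xa , yb , ab) = x≉y , suc a , suc b , xa , yb , Ext-suc⁺ e ab

  restrictP : BRel (suc n) → BRel n
  restrictP P x y = P (suc x) (suc y)

  module RestrictNode e {P} (nP : IsNode (A' e) P) where
    private module NP = Node nP

    R : BRel n
    R = restrictP P

    R-equiv : IsEquivB R
    R-equiv = (λ x → NP.≈-refl (suc x)) , (λ _ _ → NP.≈-sym) , (λ _ _ _ → NP.≈-trans)

    module _ {a b c} (ab : R a b ≡ false) (ac : R a c ≡ false) (bc : R b c ≡ false) where

      R-parts : ∀ x → (∃ λ y → y ≢ x × R x y ≡ true) → NTStrongSplit A (R x)
      R-parts x (y , y≢x , xy)
        with ntStrong-classify e (NP.part-ntStrong (suc x) (suc y , y≢x ∘ suc-injective , xy))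
      ... | inj₁ old = old
      ... | inj₂ pqSide with true-or-false (P (suc x) zero)
      ...   | inj₁ x≈p = ⊥-elim (y≢x (trans (pqSide y (trans xy (sym x≈p)))
                                  (sym (pqSide x (trans (NP.≈-refl (suc x)) (sym x≈p))))))
      ...   | inj₂ x≉p = ⊥-elim (Partition.cover-¬threeParts R-equiv covers ab ac bc)
        where
        covers : ∀ z → z ≢ q → R x z ≡ true
        covers z z≢q = ¬-not (λ xz → z≢q (pqSide z (trans xz (sym x≉p))))

      R-node : (∀ W → NTStrongSplit A W → SideWithinPart R W) → IsNode A R
      R-node within = R-equiv , (a , b , c , ab , ac , bc) , R-parts , within

    module _ (p≈q : P zero (suc q) ≡ true) where

      asOld : Fin (suc n) → Fin n
      asOld zero    = q
      asOld (suc x) = x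

      asOld-part : ∀ v y → P (suc (asOld v)) y ≡ P v y
      asOld-part zero    y = sym (NP.R-cong p≈q y)
      asOld-part (suc x) y = refl

      R-asOld : ∀ v w → R (asOld v) (asOld w) ≡ P v w
      R-asOld v w = trans (asOld-part v _) (trans (NP.R-sym v _) (trans (asOld-part w v) (NP.R-sym w v)))

      R-node-p≈q : IsNode A R
      R-node-p≈q with NP.threeParts
      ... | a , b , c , ab , ac , bc =
        R-node (trans (R-asOld a b) ab) (trans (R-asOld a c) ac) (trans (R-asOld b c) bc) within
        where
        within : ∀ W → NTStrongSplit A W → SideWithinPart R W
        within W nt with NP.ntStrong-withinPart (liftS W) (liftS-ntStrong e nt)
        ... | v , side = asOld v , Sum.map restrictSide restrictSide side
          where
          restrictSide : ∀ {b} → (∀ y → liftS W y ≡ b → P v y ≡ true) → ∀ y → W y ≡ b → R (asOld v) y ≡ true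
          restrictSide f y wy = trans (asOld-part v (suc y)) (f (suc y) wy)

      P≐liftP : P ≐ liftP q R
      P≐liftP zero    zero    = NP.≈-refl zero
      P≐liftP zero    (suc y) = sym (asOld-part zero (suc y))
      P≐liftP (suc x) zero    =
        trans (NP.R-sym (suc x) zero) (trans (sym (asOld-part zero (suc x))) (NP.R-sym (suc q) (suc x)))
      P≐liftP (suc x) (suc y) = refl

    module _ (p≉q : P zero (suc q) ≡ false) where

      P-p-isolated : IsSingleton P zero
      P-p-isolated zero    _  = refl
      P-p-isolated (suc y) py = ⊥-elim (not-¬ p≈q p≉q)
        where
        p≈q : P zero (suc q) ≡ true
        p≈q = trans (sym (ntStrong-sameSide e (NP.part-ntStrong zero (suc y , (λ ()) , py)))) (NP.≈-refl zero)

      p≉old : ∀ y → P zero (suc y) ≡ false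
      p≉old y = NP.singleton-≉ P-p-isolated (λ ())

      P-q-isolated : IsSingleton P (suc q)
      P-q-isolated zero    qp = ⊥-elim (not-¬ (NP.≈-sym qp) p≉q)
      P-q-isolated (suc y) qy with toSum (y ≟ q)
      ... | inj₁ y≡q = cong suc y≡q
      ... | inj₂ y≢q = ⊥-elim (not-¬ q≈p (NP.≉-sym p≉q))
        where
        q≈p : P (suc q) zero ≡ true
        q≈p = trans (ntStrong-sameSide e (NP.part-ntStrong (suc q) (suc y , y≢q ∘ suc-injective , qy)))
                    (NP.≈-refl (suc q))

      R-q-isolated : IsSingleton R q
      R-q-isolated y qy = suc-injective (P-q-isolated (suc y) qy)

      R-node-p≉q : ∀ {w a} → w ≢ q → a ≢ q → R w a ≡ false → IsNode A R
      R-node-p≉q w≢q a≢q wa =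
        R-node (NP.singleton-≉ P-q-isolated (w≢q ∘ suc-injective))
               (NP.singleton-≉ P-q-isolated (a≢q ∘ suc-injective)) wa within
        where
        within : ∀ W → NTStrongSplit A W → SideWithinPart R W
        within W nt@(_ , ((x , _ , wx , _) , (x' , _ , wx' , _)))
          with NP.ntStrong-withinPart (liftS W) (liftS-ntStrong e nt)
        ... | zero  , inj₁ inside  = ⊥-elim (0≢1+n (sym (P-p-isolated (suc x) (inside (suc x) wx))))
        ... | zero  , inj₂ outside = ⊥-elim (0≢1+n (sym (P-p-isolated (suc x') (outside (suc x') wx'))))
        ... | suc v , side = v , Sum.map (λ f y → f (suc y)) (λ f y → f (suc y)) side

  -- The nodes of G'

  module Leaf (Q : BRel n) (nodeQ : IsNode A Q) (q-isolated : IsSingleton Q q) where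
    private module NQ = Node nodeQ

    isq≗Q : ∀ y → isq q y ≡ Q q y
    isq≗Q y with toSum (y ≟ q)
    ... | inj₁ refl = trans (isq-self q) (sym (NQ.≈-refl q))
    ... | inj₂ y≢q  = trans (isq-≢ y≢q) (sym (NQ.singleton-≉ q-isolated y≢q))

    Q-≉q⇒≢ : ∀ {w} → Q q w ≡ false → w ≢ q
    Q-≉q⇒≢ qw refl = not-¬ (NQ.≈-refl q) qw

    twoOthers : ∃₂ λ w w' → w ≢ q × w' ≢ q × Q w w' ≡ false
    twoOthers with NQ.avoidPart q
    ... | w , qw with NQ.avoidTwoParts q w
    ...   | w' , qw' , ww' = w , w' , Q-≉q⇒≢ qw , Q-≉q⇒≢ qw' , ww'

    other : Fin n
    other = proj₁ twoOthers

    other≢q : other ≢ q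
    other≢q = proj₁ (proj₂ (proj₂ twoOthers))

    q-neighbour : Connected A → ∃ λ v → A q v
    q-neighbour conn = path-neighbour (conn q other) (other≢q ∘ sym)

    oldNode-node : ∀ e {P} → OldNode A q Q P → IsNode (A' e) P
    oldNode-node e (R , nR , R≉Q , P≐) = IsNode-resp (≐-sym P≐) (liftP-node e nR pPart)
      where
      module N = Node nR
      pPart : NTStrongSplit (A' e) (liftP q R zero)
      pPart with isolated? R q
      ... | inj₁ isolated = ⊥-elim (R≉Q (node-unique nR nodeQ isolated q-isolated))
      ... | inj₂ (y , y≢q , qy) =
        NTStrongSplit-resp liftS≗liftP (liftS-ntStrong e (N.part-ntStrong q (y , y≢q , qy)))
        where
        liftS≗liftP : liftS (R q) ≗ liftP q R zero
        liftS≗liftP zero    = N.≈-refl q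
        liftS≗liftP (suc y) = refl

    liftP-Q-node : ∀ e → NTStrongSplit (A' e) PQ → IsNode (A' e) (liftP q Q)
    liftP-Q-node e pqStrong = liftP-node e nodeQ (NTStrongSplit-resp PQ≗liftP pqStrong)
      where
      PQ≗liftP : PQ ≗ liftP q Q zero
      PQ≗liftP zero    = refl
      PQ≗liftP (suc y) = isq≗Q y

    pairP-node : ∀ e → NTStrongSplit (A' e) PQ → IsNode (A' e) (pairP q)
    pairP-node e pqStrong =
      pairP-equiv , (zero , suc q , suc other , refl , refl , pairP-q-old other≢q) , parts , within
      where

      parts : ∀ x → (∃ λ y → y ≢ x × pairP q x y ≡ true) → NTStrongSplit (A' e) (pairP q x)
      parts zero    (zero  , y≢x , _) = ⊥-elim (y≢x refl)
      parts zero    (suc y , _   , ())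
      parts (suc x) (zero  , _   , ())
      parts (suc x) (suc y , y≢x , xy) with toSum (x ≟ q)
      ... | inj₁ refl = ⊥-elim (y≢x (cong suc (isq-true (trans (sym (pairP-sameClass xy)) (isq-self q)))))
      ... | inj₂ x≢q  = NTStrongSplit-resp ∁PQ≗pairP (NTStrongSplit-∁ (A'-sym e) pqStrong)
        where
        ∁PQ≗pairP : ∁ PQ ≗ pairP q (suc x)
        ∁PQ≗pairP zero    = refl
        ∁PQ≗pairP (suc y) with toSum (y ≟ q)
        ... | inj₁ refl = trans (cong not (isq-self q)) (sym (pairP-old-q x≢q))
        ... | inj₂ y≢q  = trans (cong not (isq-≢ y≢q)) (sym (pairP-old-old x≢q y≢q))

      within : ∀ U → NTStrongSplit (A' e) U → SideWithinPart (pairP q) U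
      within U nt = suc other , [ inj₂ ∘ farSide , inj₁ ∘ farSide ]′ (true-or-false (U zero))
        where
        farSide : ∀ {b} → U zero ≡ not b → ∀ y → U y ≡ b → pairP q (suc other) y ≡ true
        farSide up zero    uy = ⊥-elim (not-¬ uy up)
        farSide up (suc y) uy with toSum (y ≟ q)
        ... | inj₁ refl = ⊥-elim (not-¬ uy (trans (sym (ntStrong-sameSide e nt)) up))
        ... | inj₂ y≢q  = pairP-old-old other≢q y≢q

    plusP-node : ∀ e → (∀ U → NTStrongSplit (A' e) U → ¬ IsPQSide U) → IsNode (A' e) (plusP Q)
    plusP-node e noPQSide = plusP-equiv (proj₁ nodeQ) , three , parts , within
      where
      three : ∃₂ λ x y → ∃ λ z → plusP Q x y ≡ false × plusP Q x z ≡ false × plusP Q y z ≡ false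
      three with NQ.threeParts
      ... | x , y , z , xy , xz , yz = suc x , suc y , suc z , xy , xz , yz

      parts : ∀ x → (∃ λ y → y ≢ x × plusP Q x y ≡ true) → NTStrongSplit (A' e) (plusP Q x)
      parts zero    (zero  , y≢x , _) = ⊥-elim (y≢x refl)
      parts zero    (suc y , _   , ())
      parts (suc x) (zero  , _   , ())
      parts (suc x) (suc y , y≢x , xy) =
        NTStrongSplit-resp liftS≗plusP (liftS-ntStrong e (NQ.part-ntStrong x (y , y≢x ∘ cong suc , xy)))
        where
        x≉q : Q x q ≡ false
        x≉q = ¬-not λ xq → y≢x (cong suc (trans (q-isolated y (NQ.≈-trans (NQ.≈-sym xq) xy))
                                               (sym (NQ.singleton-≈ q-isolated xq))))
        liftS≗plusP : liftS (Q x) ≗ plusP Q (suc x)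
        liftS≗plusP zero    = x≉q
        liftS≗plusP (suc y) = refl

      -- a part of Q containing q is {q}, too small to contain a side of a nontrivial split
      plusWithin : ∀ {U : Subset (suc n)} {x b} → U zero ≡ U (suc q) →
                   (∃₂ λ y y' → U (suc y) ≡ b × U (suc y') ≡ b × y ≢ y') →
                   (∀ y → U (suc y) ≡ b → Q x y ≡ true) → ∀ y → U y ≡ b → plusP Q (suc x) y ≡ true
      plusWithin {U} {x} {b} p∼q (y , y' , uy , uy' , y≢y') f zero up =
        ⊥-elim (y≢y' (trans (isQ y uy) (sym (isQ y' uy'))))
        where
        x≡q : x ≡ q
        x≡q = NQ.singleton-≈ q-isolated (f q (trans (sym p∼q) up))
        isQ : ∀ z → U (suc z) ≡ b → z ≡ q
        isQ z uz = q-isolated z (subst (λ x → Q x z ≡ true) x≡q (f z uz))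
      plusWithin p∼q _ f (suc y) uy = f y uy

      within : ∀ U → NTStrongSplit (A' e) U → SideWithinPart (plusP Q) U
      within U nt with ntStrong-classify e nt
      ... | inj₂ pqSide = ⊥-elim (noPQSide U nt pqSide)
      ... | inj₁ old@(_ , (inside , outside)) with NQ.ntStrong-withinPart (restrict U) old
      ...   | x , inj₁ f = suc x , inj₁ (plusWithin (ntStrong-sameSide e nt) inside f)
      ...   | x , inj₂ f = suc x , inj₂ (plusWithin (ntStrong-sameSide e nt) outside f)

    NodeShape : BRel (suc n) → Set
    NodeShape P = OldNode A q Q P ⊎ P ≐ liftP q Q ⊎ P ≐ plusP Q ⊎ P ≐ pairP q

    node-cases : ∀ e {P} → IsNode (A' e) P → NodeShape P
    node-cases e {P} nP = [ p≈q-case (isolated? R q) , p≉q-case ]′ (true-or-false (P zero (suc q)))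
      where
      open RestrictNode e nP
      module NP = Node nP

      p≈q-case : IsSingleton R q ⊎ (∃ λ y → y ≢ q × R q y ≡ true) → P zero (suc q) ≡ true → NodeShape P
      p≈q-case (inj₁ isolated) p≈q =
        inj₂ (inj₁ λ x y → trans (P≐liftP p≈q x y)
                                 (liftP-resp (node-unique (R-node-p≈q p≈q) nodeQ isolated q-isolated) x y))
      p≈q-case (inj₂ (y , y≢q , qy)) p≈q =
        inj₁ (R , R-node-p≈q p≈q , R≉Q , P≐liftP p≈q)
        where
        R≉Q : ¬ (R ≐ Q)
        R≉Q R≐Q = not-¬ (trans (sym (R≐Q q y)) qy) (NQ.singleton-≉ q-isolated y≢q)

      p≉q-case : P zero (suc q) ≡ false → NodeShape P
      p≉q-case p≉q with any? (λ a → ¬? (a ≟ q) ×-dec (R other a ≟ᵇ false))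
      ... | yes (a , a≢q , wa) = inj₂ (inj₂ (inj₁ P≐plusP))
        where
        R≐Q : R ≐ Q
        R≐Q = node-unique (R-node-p≉q p≉q other≢q a≢q wa) nodeQ (R-q-isolated p≉q) q-isolated
        P≐plusP : P ≐ plusP Q
        P≐plusP zero    zero    = NP.≈-refl zero
        P≐plusP zero    (suc y) = p≉old p≉q y
        P≐plusP (suc x) zero    = NP.≉-sym (p≉old p≉q x)
        P≐plusP (suc x) (suc y) = R≐Q x y
      ... | no none = inj₂ (inj₂ (inj₂ P≐pairP))
        where
        other≈ : ∀ a → a ≢ q → R other a ≡ true
        other≈ a a≢q = ¬-not (λ wa → none (a , a≢q , wa))
        P≐pairP : P ≐ pairP q
        P≐pairP zero    zero    = NP.≈-refl zero
        P≐pairP zero    (suc y) = p≉old p≉q y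
        P≐pairP (suc x) zero    = NP.≉-sym (p≉old p≉q x)
        P≐pairP (suc x) (suc y) with toSum (x ≟ q) | toSum (y ≟ q)
        ... | inj₁ refl | inj₁ refl = trans (NP.≈-refl (suc x)) (sym pairP-q-q)
        ... | inj₁ refl | inj₂ y≢q  =
          trans (NP.singleton-≉ (P-q-isolated p≉q) (y≢q ∘ suc-injective)) (sym (pairP-q-old y≢q))
        ... | inj₂ x≢q  | inj₁ refl =
          trans (NP.≉-sym (NP.singleton-≉ (P-q-isolated p≉q) (x≢q ∘ suc-injective))) (sym (pairP-old-q x≢q))
        ... | inj₂ x≢q  | inj₂ y≢q  =
          trans (NP.≈-trans (NP.≈-sym (other≈ x x≢q)) (other≈ y y≢q)) (sym (pairP-old-old x≢q y≢q))

    -- Quotient graphs of the new nodes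

    q-LAdj⁺ : ∀ {y b} → Q y b ≡ true → A q b → LAdj A Q q y
    q-LAdj⁺ {y} {b} yb qb = ¬-not q≈y , q , b , NQ.≈-refl q , yb , qb
      where
      q≈y : Q q y ≢ true
      q≈y qy = A-≢ qb (sym (q-isolated b (NQ.≈-trans qy yb)))

    q-LAdj⁻ : ∀ {y} → LAdj A Q q y → ∃ λ b → Q y b ≡ true × A q b
    q-LAdj⁻ (_ , a , b , qa , yb , ab) = b , yb , subst (λ a → A a b) (q-isolated a qa) ab

    module _ (e : ExtKind) where
      p-row⁻ : ∀ {y} → LAdj (A' e) (plusP Q) zero (suc y) → ∃ λ b → Q y b ≡ true × A' e zero (suc b)
      p-row⁻ (_ , zero  , suc b , _  , yb , pb) = b , yb , pb
      p-row⁻ (_ , zero  , zero  , _  , () , _)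
      p-row⁻ (_ , suc a , _     , () , _  , _)

      p-row⁺ : ∀ {y b} → Q y b ≡ true → A' e zero (suc b) → LAdj (A' e) (plusP Q) zero (suc y)
      p-row⁺ yb pb = refl , zero , _ , refl , yb , pb

    plusP-p-LAdj : ∀ e y → LAdj (A' e) (plusP Q) zero (suc y) ⇔ Ext e q (LAdj A Q) zero (suc y)
    plusP-p-LAdj pendant y = mk⇔ to from
      where
      to : LAdj (A' pendant) (plusP Q) zero (suc y) → y ≡ q
      to l with p-row⁻ pendant l
      ... | b , yb , refl = NQ.singleton-≈ q-isolated yb
      from : y ≡ q → LAdj (A' pendant) (plusP Q) zero (suc y)
      from refl = p-row⁺ pendant (NQ.≈-refl q) refl
    plusP-p-LAdj falseTwin y = mk⇔ to from
      where
      to : LAdj (A' falseTwin) (plusP Q) zero (suc y) → LAdj A Q q y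
      to l with p-row⁻ falseTwin l
      ... | b , yb , qb = q-LAdj⁺ yb qb
      from : LAdj A Q q y → LAdj (A' falseTwin) (plusP Q) zero (suc y)
      from l with q-LAdj⁻ l
      ... | b , yb , qb = p-row⁺ falseTwin yb qb
    plusP-p-LAdj trueTwin y = mk⇔ to from
      where
      to : LAdj (A' trueTwin) (plusP Q) zero (suc y) → LAdj A Q q y ⊎ y ≡ q
      to l with p-row⁻ trueTwin l
      ... | b , yb , inj₁ qb   = inj₁ (q-LAdj⁺ yb qb)
      ... | b , yb , inj₂ refl = inj₂ (NQ.singleton-≈ q-isolated yb)
      from : LAdj A Q q y ⊎ y ≡ q → LAdj (A' trueTwin) (plusP Q) zero (suc y)
      from (inj₁ l) with q-LAdj⁻ l
      ... | b , yb , qb = p-row⁺ trueTwin yb (inj₁ qb)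
      from (inj₂ refl) = p-row⁺ trueTwin (NQ.≈-refl q) (inj₂ refl)

    plusP-LAdj : ∀ e x y → LAdj (A' e) (plusP Q) x y ⇔ Ext e q (LAdj A Q) x y
    plusP-LAdj e zero    zero    = mk⇔ (λ { (() , _) }) λ ()
    plusP-LAdj e zero    (suc y) = plusP-p-LAdj e y
    plusP-LAdj e (suc x) zero    = mk⇔
      (λ l → Ext-sym e symQ zero (suc x) (Equivalence.to (plusP-p-LAdj e x) (symPlus (suc x) zero l)))
      (λ l → symPlus zero (suc x) (Equivalence.from (plusP-p-LAdj e x) (Ext-sym e symQ (suc x) zero l)))
      where
      symQ = LAdj-sym symA (proj₁ nodeQ)
      symPlus = LAdj-sym (A'-sym e) (plusP-equiv (proj₁ nodeQ))
    plusP-LAdj e (suc x) (suc y) = mk⇔ to from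
      where
      to : LAdj (A' e) (plusP Q) (suc x) (suc y) → Ext e q (LAdj A Q) (suc x) (suc y)
      to (x≉y , suc a , suc b , xa , yb , ab) = Ext-suc⁺ e (x≉y , a , b , xa , yb , Ext-suc⁻ e ab)
      to (_   , zero  , _     , () , _  , _)
      to (_   , suc a , zero  , _  , () , _)
      from : Ext e q (LAdj A Q) (suc x) (suc y) → LAdj (A' e) (plusP Q) (suc x) (suc y)
      from l with Ext-suc⁻ e l
      ... | x≉y , a , b , xa , yb , ab = x≉y , suc a , suc b , xa , yb , Ext-suc⁺ e ab

    module _ (e : ExtKind) where
      pairP-p-q⁻ : LAdj (A' e) (pairP q) zero (suc q) → A' e zero (suc q)
      pairP-p-q⁻ (_ , zero  , suc b , _  , qb , pb) =
        subst (λ b → A' e zero (suc b)) (isq-true (trans (sym (pairP-sameClass qb)) (isq-self q))) pb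
      pairP-p-q⁻ (_ , zero  , zero  , _  , () , _)
      pairP-p-q⁻ (_ , suc a , _     , () , _  , _)

      pairP-p-old⁻ : ∀ {y} → y ≢ q → LAdj (A' e) (pairP q) zero (suc y) → ∃ λ b → b ≢ q × A' e zero (suc b)
      pairP-p-old⁻ y≢q (_ , zero  , suc b , _  , yb , pb) =
        b , isq-false (trans (sym (pairP-sameClass yb)) (isq-≢ y≢q)) , pb
      pairP-p-old⁻ y≢q (_ , zero  , zero  , _  , () , _)
      pairP-p-old⁻ y≢q (_ , suc a , _     , () , _  , _)

      pairP-p-q⁺ : A' e zero (suc q) → LAdj (A' e) (pairP q) zero (suc q)
      pairP-p-q⁺ pq = refl , zero , suc q , refl , pairP-q-q , pq

      module _ {v} (qv : A q v) where
        v≢q : v ≢ q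
        v≢q = A-≢ qv ∘ sym

        pairP-p-old⁺ : IsTwin e → ∀ {y} → y ≢ q → LAdj (A' e) (pairP q) zero (suc y)
        pairP-p-old⁺ twin y≢q = refl , zero , suc v , refl , pairP-old-old y≢q v≢q , p-edge⁺ e twin qv

        pairP-q-old⁺ : ∀ {y} → y ≢ q → LAdj (A' e) (pairP q) (suc q) (suc y)
        pairP-q-old⁺ y≢q =
          pairP-q-old y≢q , suc q , suc v , pairP-q-q , pairP-old-old y≢q v≢q , Ext-suc⁺ e qv

    pairP-shape : ∀ e {v} → A q v → Q2Is (A' e) q (shapeOf e)
    pairP-shape pendant qv =
      mk⇔ (λ _ → tt) (λ _ → pairP-p-q⁺ pendant refl) ,
      λ y y≢q → mk⇔ (λ l → let (b , b≢q , b≡q) = pairP-p-old⁻ pendant y≢q l in b≢q b≡q) (λ ()) ,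
                mk⇔ (λ _ → tt) (λ _ → pairP-q-old⁺ pendant qv y≢q)
    pairP-shape falseTwin qv =
      mk⇔ (λ l → irrA q (pairP-p-q⁻ falseTwin l)) (λ ()) ,
      λ y y≢q → mk⇔ (λ _ → tt) (λ _ → pairP-p-old⁺ falseTwin qv (λ ()) y≢q) ,
                mk⇔ (λ _ → tt) (λ _ → pairP-q-old⁺ falseTwin qv y≢q)
    pairP-shape trueTwin qv =
      mk⇔ (λ _ → tt) (λ _ → pairP-p-q⁺ trueTwin (inj₂ refl)) ,
      λ y y≢q → mk⇔ (λ _ → tt) (λ _ → pairP-p-old⁺ trueTwin qv (λ ()) y≢q) ,
                mk⇔ (λ _ → tt) (λ _ → pairP-q-old⁺ trueTwin qv y≢q)

    PQSideSplit : ExtKind → Set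
    PQSideSplit e = ∃ λ U → NTStrongSplit (A' e) U × IsPQSide U

    liftP-Q-pqSide : ∀ e {P} → IsNode (A' e) P → P ≐ liftP q Q → PQSideSplit e
    liftP-Q-pqSide e {P} nP P≐liftP =
      P zero , NP.part-ntStrong zero (suc q , (λ ()) , trans (P≐liftP zero (suc q)) (NQ.≈-refl q)) , pqSide
      where
      module NP = Node nP
      pqSide : IsPQSide (P zero)
      pqSide y py = q-isolated y (trans (sym (P≐liftP zero (suc y))) (trans py (NP.≈-refl zero)))

    pairP-pqSide : ∀ e {P} → IsNode (A' e) P → P ≐ pairP q → PQSideSplit e
    pairP-pqSide e {P} nP P≐pairP with twoOthers
    ... | w , w' , w≢q , w'≢q , ww' =
      P (suc w) , NP.part-ntStrong (suc w) (suc w' , w'≢w , trans (P≐pairP _ _) (pairP-old-old w≢q w'≢q)) ,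
      pqSide
      where
      module NP = Node nP
      w'≢w : suc w' ≢ suc w
      w'≢w refl = not-¬ (NQ.≈-refl w) ww'
      pqSide : IsPQSide (P (suc w))
      pqSide y wy = decidable-stable (y ≟ q) λ y≢q →
        not-¬ (pairP-old-old w≢q y≢q) (trans (sym (P≐pairP _ _)) (trans wy (P≐pairP _ _)))

    plusP-¬pqStrong : ∀ e {P} → IsNode (A' e) P → P ≐ plusP Q → ¬ NTStrongSplit (A' e) PQ
    plusP-¬pqStrong e {P} nP P≐plusP pqStrong =
      [ pqInPart , restInPart ]′ (proj₂ (NP.ntStrong-withinPart PQ pqStrong))
      where
      module NP = Node nP
      pqInPart : ∀ {v} → (∀ y → PQ y ≡ true → P v y ≡ true) → ⊥
      pqInPart inside =
        not-¬ (NP.≈-trans (NP.≈-sym (inside zero refl)) (inside (suc q) (isq-self q))) (P≐plusP zero (suc q))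
      restInPart : ∀ {v} → (∀ y → PQ y ≡ false → P v y ≡ true) → ⊥
      restInPart outside with twoOthers
      ... | w , w' , w≢q , w'≢q , ww' =
        not-¬ (NP.≈-trans (NP.≈-sym (outside (suc w) (isq-≢ w≢q))) (outside (suc w') (isq-≢ w'≢q)))
              (trans (P≐plusP (suc w) (suc w')) ww')

    oldLabels : ∀ e → OldLabels A e q Q
    oldLabels e R nR _ = liftP-LAdj e (proj₁ nR)

    singleResult : ∀ e → ¬ PQSideSplit e → Result A q Q e single
    singleResult e noPQSide = (λ P → mk⇔ (to P) (from P)) , oldLabels e , plusP-LAdj e
      where
      to : ∀ P → IsNode (A' e) P → OldNode A q Q P ⊎ P ≐ plusP Q
      to P nP with node-cases e nP
      ... | inj₁ old                    = inj₁ old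
      ... | inj₂ (inj₁ P≐liftP)         = ⊥-elim (noPQSide (liftP-Q-pqSide e nP P≐liftP))
      ... | inj₂ (inj₂ (inj₁ P≐plusP))  = inj₂ P≐plusP
      ... | inj₂ (inj₂ (inj₂ P≐pairP))  = ⊥-elim (noPQSide (pairP-pqSide e nP P≐pairP))
      from : ∀ P → OldNode A q Q P ⊎ P ≐ plusP Q → IsNode (A' e) P
      from P (inj₁ old)     = oldNode-node e old
      from P (inj₂ P≐plusP) =
        IsNode-resp (≐-sym P≐plusP) (plusP-node e λ U nt pqSide → noPQSide (U , nt , pqSide))

    twoResult : ∀ e {v} → A q v → NTStrongSplit (A' e) PQ → Result A q Q e (two (shapeOf e))
    twoResult e qv pqStrong =
      (λ P → mk⇔ (to P) (from P)) , oldLabels e , liftP-LAdj e (proj₁ nodeQ) , pairP-shape e qv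
      where
      to : ∀ P → IsNode (A' e) P → OldNode A q Q P ⊎ P ≐ liftP q Q ⊎ P ≐ pairP q
      to P nP with node-cases e nP
      ... | inj₁ old                    = inj₁ old
      ... | inj₂ (inj₁ P≐liftP)         = inj₂ (inj₁ P≐liftP)
      ... | inj₂ (inj₂ (inj₁ P≐plusP))  = ⊥-elim (plusP-¬pqStrong e nP P≐plusP pqStrong)
      ... | inj₂ (inj₂ (inj₂ P≐pairP))  = inj₂ (inj₂ P≐pairP)
      from : ∀ P → OldNode A q Q P ⊎ P ≐ liftP q Q ⊎ P ≐ pairP q → IsNode (A' e) P
      from P (inj₁ old)             = oldNode-node e old
      from P (inj₂ (inj₁ P≐liftP))  = IsNode-resp (≐-sym P≐liftP) (liftP-Q-node e pqStrong)
      from P (inj₂ (inj₂ P≐pairP))  = IsNode-resp (≐-sym P≐pairP) (pairP-node e pqStrong)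

    -- Splits of G' separating p from q

    record Separation (e : ExtKind) : Set where
      field
        U     : Subset (suc n)
        split : IsSplit _≡_ (A' e) U
        p∈U   : U zero ≡ true
        q∉U   : U (suc q) ≡ false
        x₀    : Fin n
        x₀∈U  : U (suc x₀) ≡ true
        y₀    : Fin n
        y₀≢q  : y₀ ≢ q
        y₀∉U  : U (suc y₀) ≡ false

    pq-ntStrong : ∀ e → ¬ Separation e → NTStrongSplit (A' e) PQ
    pq-ntStrong e unseparated with twoOthers
    ... | w , w' , w≢q , w'≢q , ww' =
      (PQ-split e w≢q , strong) ,
      ((zero , suc q , refl , isq-self q , λ ()) ,
       (suc w , suc w' , isq-≢ w≢q , isq-≢ w'≢q , λ { refl → not-¬ (NQ.≈-refl w) ww' }))
      where
      separation : ∀ {U} → IsSplit _≡_ (A' e) U → U zero ≡ true → ¬ Cross _≡_ (A' e) PQ U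
      separation {U} sU p∈U ((_ , _ , _) , (z , zq , z∉U) , (suc x , xq , x∈U) , (suc y , yq , y∉U)) =
        unseparated (record { U = U ; split = sU ; p∈U = p∈U ; q∉U = q∉U z zq z∉U
                            ; x₀ = x ; x₀∈U = x∈U ; y₀ = y ; y₀≢q = isq-false yq ; y₀∉U = y∉U })
        where
        q∉U : ∀ z → PQ z ≡ true → U z ≡ false → U (suc q) ≡ false
        q∉U zero    _  p∉U = ⊥-elim (not-¬ p∈U p∉U)
        q∉U (suc z) zq z∉U = subst (λ z → U (suc z) ≡ false) (isq-true zq) z∉U
      strong : ∀ U → IsSplit _≡_ (A' e) U → ¬ Cross _≡_ (A' e) PQ U
      strong U sU cross with true-or-false (U zero)
      ... | inj₁ p∈U = separation sU p∈U cross
      ... | inj₂ p∉U = separation (IsSplit-∁ (A'-sym e) sU) (cong not p∉U) (Cross-∁ʳ {A = A' e} cross)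

    module SeparationFacts {e} (s : Separation e) where
      open Separation s public

      X : Subset n
      X = restrict U

      Z : Subset n
      Z = withQ U

      x₀≢q : x₀ ≢ q
      x₀≢q refl = not-¬ x₀∈U q∉U

      X-split : IsSplit _≡_ A X
      X-split = restrict-split e split (x₀ , x₀∈U) (q , q∉U)

      Z-split : IsSplit _≡_ A Z
      Z-split = withQ-split e split p∈U q∉U y₀≢q y₀∉U

      Z-old : ∀ {x} → x ≢ q → Z x ≡ X x
      Z-old = withQ-≢ U

      -- otherwise X or Z crosses the (strong) part of x
      X-closed : ∀ {x y} → Q x y ≡ true → X x ≡ true → X y ≡ true
      X-closed {x} {y} xy x∈X = ¬-not noEscape
        where
        x≢q : x ≢ q
        x≢q refl = not-¬ x∈X q∉U
        y≢q : y ≢ q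
        y≢q refl = x≢q (NQ.singleton-≈ q-isolated xy)
        x≉q : Q x q ≡ false
        x≉q = ¬-not (x≢q ∘ NQ.singleton-≈ q-isolated)
        w = proj₁ (NQ.avoidTwoParts x q)
        xw = proj₁ (proj₂ (NQ.avoidTwoParts x q))
        w≢q = Q-≉q⇒≢ (proj₂ (proj₂ (NQ.avoidTwoParts x q)))
        noEscape : X y ≢ false
        noEscape y∉X = [ X-crosses , Z-crosses ]′ (true-or-false (X w))
          where
          y≢x : y ≢ x
          y≢x refl = not-¬ x∈X y∉X
          X-crosses : X w ≡ true → ⊥
          X-crosses w∈X = NQ.part-noCross y≢x xy X X-split
            ((x , NQ.≈-refl x , x∈X) , (y , xy , y∉X) , (w , xw , w∈X) , (q , x≉q , q∉U))
          Z-crosses : X w ≡ false → ⊥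
          Z-crosses w∉X = NQ.part-noCross y≢x xy Z Z-split
            ((x , NQ.≈-refl x , trans (Z-old x≢q) x∈X) , (y , xy , trans (Z-old y≢q) y∉X) ,
             (q , x≉q , withQ-q U) , (w , xw , trans (Z-old w≢q) w∉X))

      X-saturated : ∀ x y → Q x y ≡ true → X x ≡ X y
      X-saturated x y xy = ⇔→≡ {z = true} (mk⇔ (X-closed xy) (X-closed (NQ.≈-sym xy)))

      X-open : ∀ {x y} → Q x y ≡ true → X x ≡ false → X y ≡ false
      X-open xy x∉X = ¬-not λ y∈X → not-¬ (X-closed (NQ.≈-sym xy) y∈X) x∉X

      X-apart : ∀ {x y} → X x ≡ true → X y ≡ false → Q x y ≡ false
      X-apart x∈X y∉X = ¬-not λ xy → not-¬ (X-closed xy x∈X) y∉X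

      Z-saturated : ∀ x y → Q x y ≡ true → Z x ≡ Z y
      Z-saturated x y xy with toSum (x ≟ q)
      ... | inj₁ refl = trans (withQ-q U) (sym (subst (λ y → Z y ≡ true) (sym (q-isolated y xy)) (withQ-q U)))
      ... | inj₂ x≢q  = trans (Z-old x≢q) (trans (X-saturated x y xy) (sym (Z-old y≢q)))
        where
        y≢q : y ≢ q
        y≢q refl = x≢q (NQ.singleton-≈ q-isolated xy)

      classes : ∀ v → X v ≡ true ⊎ v ≡ q ⊎ Z v ≡ false
      classes v with true-or-false (X v) | toSum (v ≟ q)
      ... | inj₁ v∈X | _        = inj₁ v∈X
      ... | inj₂ _   | inj₁ v≡q = inj₂ (inj₁ v≡q)
      ... | inj₂ v∉X | inj₂ v≢q = inj₂ (inj₂ (trans (Z-old v≢q) v∉X))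

      pendant-crossing : e ≡ pendant → ∀ {x z} → X x ≡ true → X z ≡ false → A x z → z ≡ q
      pendant-crossing refl = pendant-frontier (split-joined split) p∈U q∉U

      falseTwin-q-neighbours : e ≡ falseTwin → ∀ {x z} → X x ≡ true → A q x → X z ≡ false → A q z → ⊥
      falseTwin-q-neighbours refl {x} {z} x∈X qx z∉X qz =
        irrA q (split-joined split zero (suc q) p∈U q∉U (suc z , z∉X , qz) (suc x , x∈X , symA q x qx))

      trueTwin-to-q : e ≡ trueTwin → ∀ {x z} → X x ≡ true → X z ≡ false → A x z → A x q
      trueTwin-to-q refl {x} {z} x∈X z∉X xz =
        split-joined split (suc x) (suc q) x∈X q∉U (suc z , z∉X , xz) (zero , p∈U , inj₂ refl)

      trueTwin-from-q : e ≡ trueTwin → ∀ {x d} → X x ≡ true → X d ≡ false → A x d → d ≢ q → A q d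
      trueTwin-from-q refl {x} {d} x∈X d∉X xd d≢q =
        proj₂ (p-edge⁻ trueTwin d≢q
          (split-joined split zero (suc d) p∈U d∉X (suc q , q∉U , inj₂ refl) (suc x , x∈X , xd)))

      trueTwin-join : e ≡ trueTwin → ∀ {x d z} → X x ≡ true → X d ≡ false → X z ≡ false →
                      A x z → A q d → A x d
      trueTwin-join refl {x} {d} {z} x∈X d∉X z∉X xz qd =
        split-joined split (suc x) (suc d) x∈X d∉X (suc z , z∉X , xz) (zero , p∈U , inj₁ qd)

    separation-¬pqSide : ∀ e → Separation e → ¬ PQSideSplit e
    separation-¬pqSide e s (U , nt , pqSide) =
      proj₂ (proj₁ nt) V split
        (mkCross {A = A' e} (U zero) (zero , refl , p∈U) (suc q , sym (ntStrong-sameSide e nt) , q∉U)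
                 (suc x₀ , awayFromP x₀≢q , x₀∈U) (suc y₀ , awayFromP y₀≢q , y₀∉U))
      where
      open SeparationFacts s renaming (U to V)
      awayFromP : ∀ {y} → y ≢ q → U (suc y) ≡ not (U zero)
      awayFromP y≢q = ¬-not (y≢q ∘ pqSide _)

    -- When {p , q} is a strong split

    inPartOf-q : ∀ {y b} → Q y b ≡ true → b ≡ q → y ≡ q
    inPartOf-q yb refl = NQ.singleton-≈ q-isolated yb

    ¬separation-falseTwin : (∀ x → Q q x ≡ false → LAdj A Q q x) → ¬ Separation falseTwin
    ¬separation-falseTwin q-universal s = apart (neighbour x₀≢q) (neighbour y₀≢q)
      where
      open SeparationFacts s
      neighbour : ∀ {y} → y ≢ q → ∃ λ b → Q y b ≡ true × A q b
      neighbour y≢q = q-LAdj⁻ (q-universal _ (NQ.singleton-≉ q-isolated y≢q))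
      apart : (∃ λ b → Q x₀ b ≡ true × A q b) → (∃ λ b → Q y₀ b ≡ true × A q b) → ⊥
      apart (b , x₀b , qb) (b' , y₀b' , qb') =
        falseTwin-q-neighbours refl (X-closed x₀b x₀∈U) qb (X-open y₀b' y₀∉U) qb'

    ¬separation-starCenter-trueTwin : StarCenter A Q q → ¬ Separation trueTwin
    ¬separation-starCenter-trueTwin (q-universal , spokesApart) s = adjacent (neighbour x₀≢q) (neighbour y₀≢q)
      where
      open SeparationFacts s
      neighbour : ∀ {y} → y ≢ q → ∃ λ b → Q y b ≡ true × A q b
      neighbour y≢q = q-LAdj⁻ (q-universal _ (NQ.singleton-≉ q-isolated y≢q))
      adjacent : (∃ λ b → Q x₀ b ≡ true × A q b) → (∃ λ b → Q y₀ b ≡ true × A q b) → ⊥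
      adjacent (b , x₀b , qb) (w , y₀w , qw) =
        spokesApart x₀ y₀ (NQ.singleton-≉ q-isolated x₀≢q) (NQ.singleton-≉ q-isolated y₀≢q)
          (X-apart x₀∈U y₀∉U , b , w , x₀b , y₀w ,
           trueTwin-join refl (X-closed x₀b x₀∈U) (X-open y₀w y₀∉U) q∉U (symA q b qb) qw)

    ¬separation-starSpoke-pendant : (∃ λ c → StarCenter A Q c × Q c q ≡ false) → ¬ Separation pendant
    ¬separation-starSpoke-pendant (c , (c-universal , _) , c≉q) s = [ c∈X , c∉X ]′ (true-or-false (X c))
      where
      open SeparationFacts s
      c∈X : X c ≡ true → ⊥
      c∈X c∈X with c-universal y₀ (X-apart c∈X y₀∉U)
      ... | _ , a , b , ca , y₀b , ab =
        y₀≢q (inPartOf-q y₀b (pendant-crossing refl (X-closed ca c∈X) (X-open y₀b y₀∉U) ab))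
      c∉X : X c ≡ false → ⊥
      c∉X c∉X with c-universal x₀ (NQ.≉-sym (X-apart x₀∈U c∉X))
      ... | _ , a , b , ca , x₀b , ab =
        not-¬ (subst (λ a → Q c a ≡ true)
                     (pendant-crossing refl (X-closed x₀b x₀∈U) (X-open ca c∉X) (symA a b ab)) ca) c≉q

    ¬separation-starSpoke-trueTwin : (∃ λ c → StarCenter A Q c × Q c q ≡ false) → ¬ Separation trueTwin
    ¬separation-starSpoke-trueTwin (c , (c-universal , spokesApart) , c≉q) s =
      [ c∈X , c∉X ]′ (true-or-false (X c))
      where
      open SeparationFacts s
      c∈X : X c ≡ true → ⊥
      c∈X c∈X with c-universal y₀ (X-apart c∈X y₀∉U)
      ... | _ , a , b , ca , y₀b , ab =
        spokesApart q y₀ c≉q (X-apart c∈X y₀∉U)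
          (q-LAdj⁺ y₀b (trueTwin-from-q refl (X-closed ca c∈X) (X-open y₀b y₀∉U) ab (y₀≢q ∘ inPartOf-q y₀b)))
      c∉X : X c ≡ false → ⊥
      c∉X c∉X with c-universal x₀ (NQ.≉-sym (X-apart x₀∈U c∉X))
      ... | _ , a , b , ca , x₀b , ab =
        spokesApart q x₀ c≉q (NQ.≉-sym (X-apart x₀∈U c∉X))
          (q-LAdj⁺ x₀b (symA b q (trueTwin-to-q refl (X-closed x₀b x₀∈U) (X-open ca c∉X) (symA a b ab))))

    ¬separation-complete-pendant : Complete A Q → ¬ Separation pendant
    ¬separation-complete-pendant allAdjacent s = crossing (allAdjacent x₀ y₀ (X-apart x₀∈U y₀∉U))
      where
      open SeparationFacts s
      crossing : LAdj A Q x₀ y₀ → ⊥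
      crossing (_ , a , b , x₀a , y₀b , ab) =
        y₀≢q (inPartOf-q y₀b (pendant-crossing refl (X-closed x₀a x₀∈U) (X-open y₀b y₀∉U) ab))

    -- X and the complement of Z are single parts, so the quotient has exactly three vertices
    ¬separation-prime : Connected A → Prime A Q → ∀ e → ¬ Separation e
    ¬separation-prime conn (noSplit , ¬complete , ¬star) e s =
      ThreeParts.connected-three-¬prime symA (proj₁ nodeQ) cover
        (NQ.≉-sym (NQ.singleton-≉ q-isolated x₀≢q)) (X-apart x₀∈U y₀∉U) (NQ.singleton-≉ q-isolated y₀≢q)
        conn ¬complete ¬star
      where
      open SeparationFacts s
      X-within-x₀ : ∀ x → X x ≡ true → Q x₀ x ≡ true
      X-within-x₀ x x∈X = ¬-not λ x₀≉x → noSplit X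
        (quotientSplit X-saturated X-split ,
         ((x₀ , x , x₀∈U , x∈X , λ r → not-¬ r x₀≉x) ,
          (q , y₀ , q∉U , y₀∉U , λ r → not-¬ r (NQ.singleton-≉ q-isolated y₀≢q))))
      Z-outside-within-y₀ : ∀ y → Z y ≡ false → Q y₀ y ≡ true
      Z-outside-within-y₀ y y∉Z = ¬-not λ y₀≉y → noSplit Z
        (quotientSplit Z-saturated Z-split ,
         ((q , x₀ , withQ-q U , trans (Z-old x₀≢q) x₀∈U , λ r → not-¬ r (NQ.singleton-≉ q-isolated x₀≢q)) ,
          (y₀ , y , trans (Z-old y₀≢q) y₀∉U , y∉Z , λ r → not-¬ r y₀≉y)))
      cover : ∀ v → Q x₀ v ≡ true ⊎ Q q v ≡ true ⊎ Q y₀ v ≡ true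
      cover v =
        Sum.map (X-within-x₀ v) (Sum.map (λ { refl → NQ.≈-refl q }) (Z-outside-within-y₀ v)) (classes v)

    -- When {p , q} is not a strong split

    withP : Fin n → Subset (suc n)
    withP w zero    = true
    withP w (suc x) = Q w x

    separationBy : ∀ e {w w₂} → Q q w ≡ false → Q w w₂ ≡ false → w₂ ≢ q →
                   FrontiersJoined (A' e) (withP w) → Separation e
    separationBy e {w} {w₂} q≉w w≉w₂ w₂≢q joined = record
      { U = withP w ; split = mkSplit (zero , refl) (suc q , NQ.≉-sym q≉w) joined
      ; p∈U = refl ; q∉U = NQ.≉-sym q≉w
      ; x₀ = w ; x₀∈U = NQ.≈-refl w ; y₀ = w₂ ; y₀≢q = w₂≢q ; y₀∉U = w≉w₂ }

    separation-starCenter-pendant : StarCenter A Q q → Separation pendant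
    separation-starCenter-pendant (_ , spokesApart) =
      separationBy pendant q≉w w≉w₂ (Q-≉q⇒≢ q≉w₂) joined
      where
      w = proj₁ (NQ.avoidPart q)
      q≉w = proj₂ (NQ.avoidPart q)
      w₂ = proj₁ (NQ.avoidTwoParts q w)
      q≉w₂ = proj₁ (proj₂ (NQ.avoidTwoParts q w))
      w≉w₂ = proj₂ (proj₂ (NQ.avoidTwoParts q w))

      leavesTo-q : ∀ {u v} → Q w u ≡ true → Q w v ≡ false → A u v → v ≡ q
      leavesTo-q {u} {v} wu w≉v uv = decidable-stable (v ≟ q) λ v≢q →
        spokesApart w v q≉w (NQ.singleton-≉ q-isolated v≢q) (w≉v , u , v , wu , NQ.≈-refl v , uv)

      joined : FrontiersJoined (A' pendant) (withP w)
      joined a       zero    _  ()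
      joined zero    (suc d) _  _  _ (zero  , _  , pd) = pd
      joined zero    (suc d) _  wd _ (suc c , wc , cd) = leavesTo-q wc wd cd
      joined (suc a) (suc d) _  _  (zero  , () , _) _
      joined (suc a) (suc d) wa wd (suc b , wb , ab) (zero , _ , d≡q) =
        subst (A a) (trans (leavesTo-q wa wb ab) (sym d≡q)) ab
      joined (suc a) (suc d) wa wd (suc b , wb , ab) (suc c , wc , cd) =
        NQ.part-joined w a d wa wd (b , wb , ab) (c , wc , cd)

    separation-starSpoke-falseTwin : (∃ λ c → StarCenter A Q c × Q c q ≡ false) → Separation falseTwin
    separation-starSpoke-falseTwin (c , (_ , spokesApart) , c≉q) =
      separationBy falseTwin q≉w (NQ.≉-sym c≉w) c≢q joined
      where
      w = proj₁ (NQ.avoidTwoParts c q)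
      c≉w = proj₁ (proj₂ (NQ.avoidTwoParts c q))
      q≉w = proj₂ (proj₂ (NQ.avoidTwoParts c q))
      c≢q : c ≢ q
      c≢q refl = not-¬ (NQ.≈-refl q) c≉q

      w-leavesTo-c : ∀ {u v} → Q w u ≡ true → Q w v ≡ false → A u v → Q c v ≡ true
      w-leavesTo-c {u} {v} wu w≉v uv = ¬-not λ c≉v →
        spokesApart w v c≉w c≉v (w≉v , u , v , wu , NQ.≈-refl v , uv)
      q-leavesTo-c : ∀ {v} → A q v → Q c v ≡ true
      q-leavesTo-c {v} qv = ¬-not λ c≉v →
        spokesApart q v c≉q c≉v
          (NQ.singleton-≉ q-isolated (A-≢ qv ∘ sym) , q , v , NQ.≈-refl q , NQ.≈-refl v , qv)

      joined : FrontiersJoined (A' falseTwin) (withP w)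
      joined a       zero    _  ()
      joined zero    (suc d) _  _  _ (zero , _ , qd) = qd
      joined zero    (suc d) _  _  (zero , () , _) _
      joined zero    (suc d) _  wd (suc b , _ , qb) (suc c' , wc' , c'd) =
        symA d q (NQ.part-joined c d q (w-leavesTo-c wc' wd c'd) c≉q
                   (c' , NQ.≉-≈-trans c≉w wc' , symA c' d c'd) (b , q-leavesTo-c qb , symA q b qb))
      joined (suc a) (suc d) _  _  (zero , () , _) _
      joined (suc a) (suc d) wa wd (suc b , wb , ab) (zero , _ , qd) =
        symA d a (NQ.part-joined c d a (q-leavesTo-c qd) (NQ.≉-≈-trans c≉w wa)
                   (q , c≉q , symA q d qd) (b , w-leavesTo-c wa wb ab , symA a b ab))
      joined (suc a) (suc d) wa wd (suc b , wb , ab) (suc c' , wc' , c'd) =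
        NQ.part-joined w a d wa wd (b , wb , ab) (c' , wc' , c'd)

    separation-complete-trueTwin : Complete A Q → Separation trueTwin
    separation-complete-trueTwin allAdjacent =
      separationBy trueTwin q≉w w≉w₂ (Q-≉q⇒≢ q≉w₂) joined
      where
      w = proj₁ (NQ.avoidPart q)
      q≉w = proj₂ (NQ.avoidPart q)
      w₂ = proj₁ (NQ.avoidTwoParts q w)
      q≉w₂ = proj₁ (proj₂ (NQ.avoidTwoParts q w))
      w≉w₂ = proj₂ (proj₂ (NQ.avoidTwoParts q w))

      toQ : ∀ {v} → Q q v ≡ false → ∃ λ b → Q v b ≡ true × A b q
      toQ q≉v with q-LAdj⁻ (allAdjacent q _ q≉v)
      ... | b , vb , qb = b , vb , symA q b qb

      -- d has a neighbour outside its part and, by completeness, q has one inside it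
      q-neighbour-joins : ∀ {d u} → d ≢ q → Q d u ≡ false → A u d → A q d
      q-neighbour-joins {d} {u} d≢q d≉u ud =
        symA d q (NQ.part-joined d d q (NQ.≈-refl d) (NQ.≉-sym (NQ.singleton-≉ q-isolated d≢q))
                   (u , d≉u , symA u d ud) (toQ (NQ.singleton-≉ q-isolated d≢q)))

      joined : FrontiersJoined (A' trueTwin) (withP w)
      joined a       zero    _  ()
      joined zero    (suc d) _  _  _ (zero , _ , pd) = pd
      joined zero    (suc d) _  wd _ (suc c , wc , cd) with toSum (d ≟ q)
      ... | inj₁ d≡q = inj₂ d≡q
      ... | inj₂ d≢q = inj₁ (q-neighbour-joins d≢q (NQ.≉-≈-trans (NQ.≉-sym wd) wc) cd)
      joined (suc a) (suc d) _  _  (zero , () , _) _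
      joined (suc a) (suc d) wa wd (suc b , wb , ab) (suc c , wc , cd) =
        NQ.part-joined w a d wa wd (b , wb , ab) (c , wc , cd)
      joined (suc a) (suc d) wa wd (suc b , wb , ab) (zero , _ , inj₂ refl) =
        NQ.part-joined w a q wa (NQ.≉-sym q≉w) (b , wb , ab) (toQ q≉w)
      joined (suc a) (suc d) wa wd (suc b , wb , ab) (zero , _ , inj₁ qd) with allAdjacent w d wd
      ... | _ , u , v , wu , dv , uv =
        NQ.part-joined w a d wa wd (b , wb , ab)
          (u , wu , symA d u (NQ.part-joined d d u (NQ.≈-refl d) (NQ.≉-≈-trans (NQ.≉-sym wd) wu)
                                (q , NQ.≉-sym (NQ.singleton-≉ q-isolated d≢q) , symA q d qd)
                                (v , dv , symA u v uv)))
        where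
        d≢q : d ≢ q
        d≢q refl = irrA q qd

lemma1 : ∀ {n : ℕ} (A : Rel n) → Symmetric A → Irreflexive A → Connected A → 3 ≤ n →
         (q : Fin n) (Q : BRel n) → IsNode A Q → (∀ y → Q q y ≡ true → y ≡ q) →
         (t : QType) → HasType A Q q t → (e : ExtKind) →
         Result A q Q e (expected t e)
lemma1 A symA irrA conn _ q Q nodeQ q-isolated t hasType e = result t e hasType
  where
  open Extension A symA irrA q
  open Leaf Q nodeQ q-isolated

  newSplit : ∀ {e} → ¬ Separation e → Result A q Q e (two (shapeOf e))
  newSplit unseparated = twoResult _ (proj₂ (q-neighbour conn)) (pq-ntStrong _ unseparated)

  inPlace : ∀ {e} → Separation e → Result A q Q e single
  inPlace s = singleResult _ (separation-¬pqSide _ s)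

  result : ∀ t e → HasType A Q q t → Result A q Q e (expected t e)
  result starCenter pendant   h = inPlace (separation-starCenter-pendant h)
  result starCenter falseTwin h = newSplit (¬separation-falseTwin (proj₁ h))
  result starCenter trueTwin  h = newSplit (¬separation-starCenter-trueTwin h)
  result starSpoke  pendant   h = newSplit (¬separation-starSpoke-pendant h)
  result starSpoke  falseTwin h = inPlace (separation-starSpoke-falseTwin h)
  result starSpoke  trueTwin  h = newSplit (¬separation-starSpoke-trueTwin h)
  result complete   pendant   h = newSplit (¬separation-complete-pendant h)
  result complete   falseTwin h = newSplit (¬separation-falseTwin (h q))
  result complete   trueTwin  h = inPlace (separation-complete-trueTwin h)
  result prime      pendant   h = newSplit (¬separation-prime conn h pendant)
  result prime      falseTwin h = newSplit (¬separation-prime conn h falseTwin)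
  result prime      trueTwin  h = newSplit (¬separation-prime conn h trueTwin)
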